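{- (Subject reduction.) (1) If $\Gamma\vdash M:A$ and $M\to M'$, then $\Gamma\vdash M':A$. (2) If $\Gamma;B\vdash l:C$ and $l\to l'$, then $\Gamma;B\vdash l':C$.
   Context: Ground PTSC syntax: given sorts $\mathcal S$ and variables, terms $M ::= \Pi x^{A}.B \mid \lambda x^{A}.M \mid s \mid x\,l \mid M\,l \mid \langle N/x\rangle_A M$ and lists $l ::= [\,] \mid M\cdot l \mid l @ l' \mid \langle N/x\rangle_A l$ ($\langle N/x\rangle_A$ explicit substitution binding $x$; $\Pi,\lambda$ bind $x$; up to $\alpha$-conversion). One-step reduction $\to$ is the contextual closure (inside terms and lists) of: $(\lambda x^A.M)(N\cdot l)\to(\langle N/x\rangle_A M)\,l$; $M\,[\,]\to M$; $(x\,l)\,l'\to x\,(l@l')$; $(M\,l)\,l'\to M\,(l@l')$; $(M\cdot l')@l\to M\cdot(l'@l)$; $[\,]@l\to l$; $(l@l')@l''\to l@(l'@l'')$; $l@[\,]\to l$; $\langle P/y\rangle_G(\lambda x^A.M)\to\lambda x^{\langle P/y\rangle_G A}.\langle P/y\rangle_G M$; $\langle P/y\rangle_G(y\,l)\to P\,(\langle P/y\rangle_G l)$; $\langle P/y\rangle_G(x\,l)\to x\,(\langle P/y\rangle_G l)$ ($x\ne y$); $\langle P/y\rangle_G(M\,l)\to(\langle P/y\rangle_G M)(\langle P/y\rangle_G l)$; $\langle P/y\rangle_G(\Pi x^A.B)\to\Pi x^{\langle P/y\rangle_G A}.\langle P/y\rangle_G B$; $\langle P/y\rangle_G s\to s$;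 $\langle P/y\rangle_G[\,]\to[\,]$; $\langle P/y\rangle_G(M\cdot l)\to(\langle P/y\rangle_G M)\cdot(\langle P/y\rangle_G l)$; $\langle P/y\rangle_G(l@l')\to(\langle P/y\rangle_G l)@(\langle P/y\rangle_G l')$ (capture avoidance understood). $\leftrightarrow^*$ is the induced equivalence. A PTSC is given by $\mathcal A\subseteq\mathcal S^2$, $\mathcal R\subseteq\mathcal S^3$. An environment is a list of declarations $(x:A)$; $\mathrm{dom}$ is the list of declared variables; $\langle P/x\rangle_A\Delta$ applies $\langle P/x\rangle_A$ to every type in $\Delta$; $\Gamma\sqsubseteq\Delta$ means for each $(x:A)\in\Gamma$ there is $(x:B)\in\Delta$ with $A\leftrightarrow^*B$. Judgements $\Gamma\ \mathsf{wf}$, $\Gamma\vdash M:A$, $\Gamma;B\vdash l:C$ are derived by: (empty) $\emptyset\ \mathsf{wf}$; (extend) $\Gamma\vdash A:s$, $x\notin\mathrm{dom}\,\Gamma$ $\Rightarrow$ $\Gamma,(x:A)\ \mathsf{wf}$; (sorted) $\Gamma\ \mathsf{wf}$, $(s,s')\in\mathcal A$ $\Rightarrow$ $\Gamma\vdash s:s'$; ($\Pi$wf) $\Gamma\vdash A:s_1$, $\Gamma,(x:A)\vdash B:s_2$, $(s_1,s_2,s_3)\in\mathcal R$ $\Rightarrow$ $\Gamma\vdash\Pi x^A.B:s_3$; ($\Pi$R) $\Gamma\vdash\Pi x^A.B:s$, $\Gamma,(x:A)\vdash M:B$ $\Rightarrow$ $\Gamma\vdash\lambda x^A.M:\Pi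 x^A.B$; (select) $\Gamma;A\vdash l:B$, $(x:A)\in\Gamma$ $\Rightarrow$ $\Gamma\vdash x\,l:B$; (axiom) $\Gamma\vdash A:s$ $\Rightarrow$ $\Gamma;A\vdash[\,]:A$; (conv$_R$) $\Gamma\vdash M:A$, $\Gamma\vdash B:s$, $A\leftrightarrow^*B$ $\Rightarrow$ $\Gamma\vdash M:B$; ($\Pi$L) $\Gamma\vdash\Pi x^A.B:s$, $\Gamma\vdash M:A$, $\Gamma;\langle M/x\rangle_A B\vdash l:C$ $\Rightarrow$ $\Gamma;\Pi x^A.B\vdash M\cdot l:C$; (conv$'_R$) $\Gamma;C\vdash l:A$, $\Gamma\vdash B:s$, $A\leftrightarrow^*B$ $\Rightarrow$ $\Gamma;C\vdash l:B$; (conv$_L$) $\Gamma;A\vdash l:C$, $\Gamma\vdash B:s$, $A\leftrightarrow^*B$ $\Rightarrow$ $\Gamma;B\vdash l:C$; (Cut$_1$) $\Gamma;C\vdash l':A$, $\Gamma;A\vdash l:B$ $\Rightarrow$ $\Gamma;C\vdash l'@l:B$; (Cut$_2$) $\Gamma\vdash P:A$, $\Gamma,(x:A),\Delta;B\vdash l:C$, $\Gamma,\langle P/x\rangle_A\Delta\sqsubseteq\Delta'$, $\Delta'\ \mathsf{wf}$ $\Rightarrow$ $\Delta';\langle P/x\rangle_A B\vdash\langle P/x\rangle_A l:\langle P/x\rangle_A C$; (Cut$_3$) $\Gamma\vdash M:A$, $\Gamma;A\vdash l:B$ $\Rightarrow$ $\Gamma\vdash M\,l:B$; (Cut$_4$)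 $\Gamma\vdash P:A$, $\Gamma,(x:A),\Delta\vdash M:C$, $\Gamma,\langle P/x\rangle_A\Delta\sqsubseteq\Delta'$, $\Delta'\ \mathsf{wf}$ $\Rightarrow$ $\Delta'\vdash\langle P/x\rangle_A M:C'$, where $C'=C$ if $C\in\mathcal S$ and $C'=\langle P/x\rangle_A C$ otherwise. In all rules $s,s',s_i\in\mathcal S$. -}

module Defs where

-- Locally: de Bruijn representation of PTSC syntax (canonical representatives
-- of alpha-classes).  Index 0 = most recently bound variable.

open import Data.Nat using (ℕ; zero; suc; _+_)
open import Data.List using (List; []; _∷_; _++_; length)
open import Data.Product using (Σ; _×_)
open import Relation.Binary.PropositionalEquality using (_≡_)
open import Function.Definitions using (Injective)
open import Relation.Binary.Construct.Closure.Equivalence using (EqClosure)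

module PTSC {S : Set} (Ax : S → S → Set) (Rl : S → S → S → Set) where

  -- Syntax
  --   Π A B      = Π x^A.B        (B under one binder)
  --   ƛ A M      = λ x^A.M        (M under one binder)
  --   srt s      = s
  --   var x l    = x l
  --   app M l    = M l
  --   esub N A M = ⟨N/x⟩_A M      (only M under the binder x)
  --   nil, M ∷ₗ l, l ++ₗ l', esubₗ N A l  = [], M·l, l@l', ⟨N/x⟩_A l

  mutual
    data Tm : Set where
      Π    : Tm → Tm → Tm
      ƛ    : Tm → Tm → Tm
      srt  : S → Tm
      var  : ℕ → Lst → Tm
      app  : Tm → Lst → Tm
      esub : Tm → Tm → Tm → Tm

    data Lst : Set where
      nil   : Lst
      _∷ₗ_  : Tm → Lst → Lst
      _++ₗ_ : Lst → Lst → Lst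
      esubₗ : Tm → Tm → Lst → Lst

  infixr 5 _∷ₗ_ _++ₗ_
  infix 4 _⟶_ _⟶ₗ_ _↔*_

  lift : (ℕ → ℕ) → ℕ → ℕ
  lift ρ zero    = zero
  lift ρ (suc n) = suc (ρ n)

  mutual
    renT : (ℕ → ℕ) → Tm → Tm
    renT ρ (Π A B)      = Π (renT ρ A) (renT (lift ρ) B)
    renT ρ (ƛ A M)      = ƛ (renT ρ A) (renT (lift ρ) M)
    renT ρ (srt s)      = srt s
    renT ρ (var x l)    = var (ρ x) (renL ρ l)
    renT ρ (app M l)    = app (renT ρ M) (renL ρ l)
    renT ρ (esub N A M) = esub (renT ρ N) (renT ρ A) (renT (lift ρ) M)

    renL : (ℕ → ℕ) → Lst → Lst
    renL ρ nil           = nil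
    renL ρ (M ∷ₗ l)      = renT ρ M ∷ₗ renL ρ l
    renL ρ (l ++ₗ l')    = renL ρ l ++ₗ renL ρ l'
    renL ρ (esubₗ N A l) = esubₗ (renT ρ N) (renT ρ A) (renL (lift ρ) l)

  wk : Tm → Tm
  wk = renT suc

  swap01 : ℕ → ℕ
  swap01 zero          = suc zero
  swap01 (suc zero)    = zero
  swap01 (suc (suc n)) = suc (suc n)

  mutual
    data _⟶_ : Tm → Tm → Set where
      β       : ∀ {A M N l} → app (ƛ A M) (N ∷ₗ l) ⟶ app (esub N A M) l
      app-nil : ∀ {M} → app M nil ⟶ M
      app-var : ∀ {x l l'} → app (var x l) l' ⟶ var x (l ++ₗ l')
      app-app : ∀ {M l l'} → app (app M l) l' ⟶ app M (l ++ₗ l')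
      σ-ƛ     : ∀ {P G A M} →
                esub P G (ƛ A M) ⟶ ƛ (esub P G A) (esub (wk P) (wk G) (renT swap01 M))
      σ-var₀  : ∀ {P G l} → esub P G (var zero l) ⟶ app P (esubₗ P G l)
      σ-varₛ  : ∀ {P G x l} → esub P G (var (suc x) l) ⟶ var x (esubₗ P G l)
      σ-app   : ∀ {P G M l} → esub P G (app M l) ⟶ app (esub P G M) (esubₗ P G l)
      σ-Π     : ∀ {P G A B} →
                esub P G (Π A B) ⟶ Π (esub P G A) (esub (wk P) (wk G) (renT swap01 B))
      σ-srt   : ∀ {P G s} → esub P G (srt s) ⟶ srt s
      Π₁    : ∀ {A A' B} → A ⟶ A' → Π A B ⟶ Π A' B
      Π₂    : ∀ {A B B'} → B ⟶ B' → Π A B ⟶ Π A B'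
      ƛ₁    : ∀ {A A' M} → A ⟶ A' → ƛ A M ⟶ ƛ A' M
      ƛ₂    : ∀ {A M M'} → M ⟶ M' → ƛ A M ⟶ ƛ A M'
      var₁  : ∀ {x l l'} → l ⟶ₗ l' → var x l ⟶ var x l'
      app₁  : ∀ {M M' l} → M ⟶ M' → app M l ⟶ app M' l
      app₂  : ∀ {M l l'} → l ⟶ₗ l' → app M l ⟶ app M l'
      esub₁ : ∀ {N N' A M} → N ⟶ N' → esub N A M ⟶ esub N' A M
      esub₂ : ∀ {N A A' M} → A ⟶ A' → esub N A M ⟶ esub N A' M
      esub₃ : ∀ {N A M M'} → M ⟶ M' → esub N A M ⟶ esub N A M'

    data _⟶ₗ_ : Lst → Lst → Set where
      cat-cons  : ∀ {M l l'} → (M ∷ₗ l') ++ₗ l ⟶ₗ M ∷ₗ (l' ++ₗ l)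
      cat-nil   : ∀ {l} → nil ++ₗ l ⟶ₗ l
      cat-assoc : ∀ {l l' l''} → (l ++ₗ l') ++ₗ l'' ⟶ₗ l ++ₗ (l' ++ₗ l'')
      cat-nilʳ  : ∀ {l} → l ++ₗ nil ⟶ₗ l
      σ-nil     : ∀ {P G} → esubₗ P G nil ⟶ₗ nil
      σ-cons    : ∀ {P G M l} → esubₗ P G (M ∷ₗ l) ⟶ₗ esub P G M ∷ₗ esubₗ P G l
      σ-cat     : ∀ {P G l l'} → esubₗ P G (l ++ₗ l') ⟶ₗ esubₗ P G l ++ₗ esubₗ P G l'
      cons₁  : ∀ {M M' l} → M ⟶ M' → M ∷ₗ l ⟶ₗ M' ∷ₗ l
      cons₂  : ∀ {M l l'} → l ⟶ₗ l' → M ∷ₗ l ⟶ₗ M ∷ₗ l'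
      cat₁   : ∀ {l₁ l₁' l₂} → l₁ ⟶ₗ l₁' → l₁ ++ₗ l₂ ⟶ₗ l₁' ++ₗ l₂
      cat₂   : ∀ {l₁ l₂ l₂'} → l₂ ⟶ₗ l₂' → l₁ ++ₗ l₂ ⟶ₗ l₁ ++ₗ l₂'
      esubₗ₁ : ∀ {N N' A l} → N ⟶ N' → esubₗ N A l ⟶ₗ esubₗ N' A l
      esubₗ₂ : ∀ {N A A' l} → A ⟶ A' → esubₗ N A l ⟶ₗ esubₗ N A' l
      esubₗ₃ : ∀ {N A l l'} → l ⟶ₗ l' → esubₗ N A l ⟶ₗ esubₗ N A l'

  _↔*_ : Tm → Tm → Set
  _↔*_ = EqClosure _⟶_

  -- Environments: lists of types, head = most recent declaration.
  -- Γ , (x : A)  is  A ∷ Γ ;   Γ , Δ  is  Δ ++ Γ.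

  Ctx : Set
  Ctx = List Tm

  -- (x : A) ∈ Γ, with A weakened to the scope of the whole of Γ
  data _∋_⦂_ : Ctx → ℕ → Tm → Set where
    here  : ∀ {Γ A} → (A ∷ Γ) ∋ zero ⦂ wk A
    there : ∀ {Γ n A B} → Γ ∋ n ⦂ A → (B ∷ Γ) ∋ suc n ⦂ wk A

  -- For a term in scope Γ,(x:A),Δ with |Δ| = j, mv j moves x to index 0,
  -- giving a term in scope Γ,Δ,(x:A).
  bump : ℕ → ℕ
  bump zero    = zero
  bump (suc m) = suc (suc m)

  mv : ℕ → ℕ → ℕ
  mv zero    k       = k
  mv (suc j) zero    = suc zero
  mv (suc j) (suc k) = bump (mv j k)

  -- ⟨P/x⟩_A T for T in scope Γ,(x:A),Δ (|Δ| = j), P and A in scope Γ;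
  -- the result lives in scope Γ,Δ.
  esubAt : ℕ → Tm → Tm → Tm → Tm
  esubAt j P A T = esub (renT (j +_) P) (renT (j +_) A) (renT (mv j) T)

  esubAtₗ : ℕ → Tm → Tm → Lst → Lst
  esubAtₗ j P A l = esubₗ (renT (j +_) P) (renT (j +_) A) (renL (mv j) l)

  esubCtx : Tm → Tm → Ctx → Ctx
  esubCtx P A []      = []
  esubCtx P A (D ∷ Δ) = esubAt (length Δ) P A D ∷ esubCtx P A Δ

  -- Θ ⊑ Δ' : with named variables, every (x:A) ∈ Θ has (x:B) ∈ Δ' with A ↔* B.
  -- In de Bruijn form the identification of names is an injective map ρ
  -- from positions of Θ to positions of Δ'.
  record _⊑[_]_ (Θ : Ctx) (ρ : ℕ → ℕ) (Δ' : Ctx) : Set where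
    field
      ρ-injective : Injective _≡_ _≡_ ρ
      ρ-decl      : ∀ {k T} → Θ ∋ k ⦂ T →
                    Σ Tm (λ T' → (Δ' ∋ ρ k ⦂ T') × (renT ρ T ↔* T'))

  -- C' in rule Cut₄ (already transported to Δ' by ρ)
  cut4Ty : (ℕ → ℕ) → ℕ → Tm → Tm → Tm → Tm
  cut4Ty ρ j P A (srt s) = srt s
  cut4Ty ρ j P A C       = renT ρ (esubAt j P A C)

  infix 4 _wf _⊢_⦂_ _⍮_⊢_⦂_

  mutual
    data _wf : Ctx → Set where
      empty  : [] wf
      extend : ∀ {Γ A s} → Γ ⊢ A ⦂ srt s → (A ∷ Γ) wf

    data _⊢_⦂_ : Ctx → Tm → Tm → Set where
      sorted : ∀ {Γ s s'} → Γ wf → Ax s s' → Γ ⊢ srt s ⦂ srt s'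
      Πwf    : ∀ {Γ A B s₁ s₂ s₃} →
               Γ ⊢ A ⦂ srt s₁ → (A ∷ Γ) ⊢ B ⦂ srt s₂ → Rl s₁ s₂ s₃ →
               Γ ⊢ Π A B ⦂ srt s₃
      ΠR     : ∀ {Γ A B M s} →
               Γ ⊢ Π A B ⦂ srt s → (A ∷ Γ) ⊢ M ⦂ B → Γ ⊢ ƛ A M ⦂ Π A B
      select : ∀ {Γ A B x l} → Γ ⍮ A ⊢ l ⦂ B → Γ ∋ x ⦂ A → Γ ⊢ var x l ⦂ B
      convR  : ∀ {Γ M A B s} → Γ ⊢ M ⦂ A → Γ ⊢ B ⦂ srt s → A ↔* B → Γ ⊢ M ⦂ B
      cut3   : ∀ {Γ M A B l} → Γ ⊢ M ⦂ A → Γ ⍮ A ⊢ l ⦂ B → Γ ⊢ app M l ⦂ B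
      cut4   : ∀ {Γ Δ Δ' P A M C ρ} →
               Γ ⊢ P ⦂ A → (Δ ++ (A ∷ Γ)) ⊢ M ⦂ C →
               (esubCtx P A Δ ++ Γ) ⊑[ ρ ] Δ' → Δ' wf →
               Δ' ⊢ renT ρ (esubAt (length Δ) P A M) ⦂ cut4Ty ρ (length Δ) P A C

    data _⍮_⊢_⦂_ : Ctx → Tm → Lst → Tm → Set where
      axiom : ∀ {Γ A s} → Γ ⊢ A ⦂ srt s → Γ ⍮ A ⊢ nil ⦂ A
      ΠL    : ∀ {Γ A B M l C s} →
              Γ ⊢ Π A B ⦂ srt s → Γ ⊢ M ⦂ A → Γ ⍮ esub M A B ⊢ l ⦂ C →
              Γ ⍮ Π A B ⊢ M ∷ₗ l ⦂ C
      conv'R : ∀ {Γ C l A B s} → Γ ⍮ C ⊢ l ⦂ A → Γ ⊢ B ⦂ srt s → A ↔* B → Γ ⍮ C ⊢ l ⦂ B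
      convL  : ∀ {Γ A l C B s} → Γ ⍮ A ⊢ l ⦂ C → Γ ⊢ B ⦂ srt s → A ↔* B → Γ ⍮ B ⊢ l ⦂ C
      cut1   : ∀ {Γ C l' A l B} → Γ ⍮ C ⊢ l' ⦂ A → Γ ⍮ A ⊢ l ⦂ B → Γ ⍮ C ⊢ l' ++ₗ l ⦂ B
      cut2   : ∀ {Γ Δ Δ' P A B l C ρ} →
               Γ ⊢ P ⦂ A → (Δ ++ (A ∷ Γ)) ⍮ B ⊢ l ⦂ C →
               (esubCtx P A Δ ++ Γ) ⊑[ ρ ] Δ' → Δ' wf →
               Δ' ⍮ renT ρ (esubAt (length Δ) P A B) ⊢ renL ρ (esubAtₗ (length Δ) P A l)
                  ⦂ renT ρ (esubAt (length Δ) P A C)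

module Submission where

-- The typing rules contain conversion (A ↔* B), so the proof needs facts
-- about convertibility that rest on confluence: Π-types are injective,
-- sorts are injective, and convertibility is stable under renaming.  We get
-- them by translating PTSC terms into ordinary λ-terms (spines become
-- iterated applications, explicit substitutions meta-level substitutions):
-- the translation maps ⟶ into parallel β-reduction, and every term is
-- convertible to the read-back of its image, so A ↔* B holds exactly when
-- the images are β-convertible; Church–Rosser for λ-terms does the rest.

open import Defs
open import Data.Nat using (ℕ; zero; suc; _+_; _≤_; s≤s)
open import Data.Nat.Properties using (<⇒≤; ≤-refl; +-cancelˡ-≡; suc-injective)
open import Data.List using (List; []; _∷_; _++_; length; map)
open import Data.List.Properties using (++-assoc; ++-identityʳ; map-++; map-∘; map-cong)
open import Data.List.Relation.Binary.Pointwise as Pointwise using (Pointwise; []; _∷_)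
open import Data.Product using (Σ; _×_; _,_; proj₁; proj₂)
open import Data.Sum using (_⊎_; inj₁; inj₂)
open import Function using (_∘_; id)
open import Function.Definitions using (Injective)
open import Relation.Binary.PropositionalEquality
open import Relation.Binary.Construct.Closure.ReflexiveTransitive using (Star; ε; _◅_; _◅◅_)
open import Relation.Binary.Construct.Closure.Symmetric using (fwd; bwd)
open import Relation.Binary.Construct.Closure.Equivalence as EqClosure using (EqClosure; gmap)

-- Pure λ-terms with Π-types and sorts, in de Bruijn notation, and the
-- Church–Rosser theorem for β-reduction, proved via parallel reduction and
-- complete developments.

module Lambda (S : Set) where

  infixl 7 _·_

  data Λ : Set where
    v    : ℕ → Λ
    _·_  : Λ → Λ → Λ
    lam  : Λ → Λ → Λ
    pi   : Λ → Λ → Λ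
    sort : S → Λ

  ext : (ℕ → ℕ) → ℕ → ℕ
  ext ρ zero    = zero
  ext ρ (suc n) = suc (ρ n)

  ren : (ℕ → ℕ) → Λ → Λ
  ren ρ (v x)     = v (ρ x)
  ren ρ (t · u)   = ren ρ t · ren ρ u
  ren ρ (lam a m) = lam (ren ρ a) (ren (ext ρ) m)
  ren ρ (pi a m)  = pi (ren ρ a) (ren (ext ρ) m)
  ren ρ (sort s)  = sort s

  Sub : Set
  Sub = ℕ → Λ

  exts : Sub → Sub
  exts σ zero    = v zero
  exts σ (suc n) = ren suc (σ n)

  sub : Sub → Λ → Λ
  sub σ (v x)     = σ x
  sub σ (t · u)   = sub σ t · sub σ u
  sub σ (lam a m) = lam (sub σ a) (sub (exts σ) m)
  sub σ (pi a m)  = pi (sub σ a) (sub (exts σ) m)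
  sub σ (sort s)  = sort s

  _•_ : Λ → Sub
  t • zero  = t
  t • suc n = v n

  sub₀ : Λ → Λ → Λ
  sub₀ n = sub (n •_)

  ext-cong : ∀ {ρ ρ'} → ρ ≗ ρ' → ext ρ ≗ ext ρ'
  ext-cong e zero    = refl
  ext-cong e (suc x) = cong suc (e x)

  ren-cong : ∀ {ρ ρ'} → ρ ≗ ρ' → ren ρ ≗ ren ρ'
  ren-cong e (v x)     = cong v (e x)
  ren-cong e (t · u)   = cong₂ _·_ (ren-cong e t) (ren-cong e u)
  ren-cong e (lam a m) = cong₂ lam (ren-cong e a) (ren-cong (ext-cong e) m)
  ren-cong e (pi a m)  = cong₂ pi (ren-cong e a) (ren-cong (ext-cong e) m)
  ren-cong e (sort s)  = refl

  exts-cong : ∀ {σ σ'} → σ ≗ σ' → exts σ ≗ exts σ'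
  exts-cong e zero    = refl
  exts-cong e (suc x) = cong (ren suc) (e x)

  sub-cong : ∀ {σ σ'} → σ ≗ σ' → sub σ ≗ sub σ'
  sub-cong e (v x)     = e x
  sub-cong e (t · u)   = cong₂ _·_ (sub-cong e t) (sub-cong e u)
  sub-cong e (lam a m) = cong₂ lam (sub-cong e a) (sub-cong (exts-cong e) m)
  sub-cong e (pi a m)  = cong₂ pi (sub-cong e a) (sub-cong (exts-cong e) m)
  sub-cong e (sort s)  = refl

  ext-∘ : ∀ ρ ρ' → ext ρ ∘ ext ρ' ≗ ext (ρ ∘ ρ')
  ext-∘ ρ ρ' zero    = refl
  ext-∘ ρ ρ' (suc x) = refl

  ren-ren : ∀ ρ ρ' t → ren ρ (ren ρ' t) ≡ ren (ρ ∘ ρ') t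
  ren-ren ρ ρ' (v x)     = refl
  ren-ren ρ ρ' (t · u)   = cong₂ _·_ (ren-ren ρ ρ' t) (ren-ren ρ ρ' u)
  ren-ren ρ ρ' (lam a m) =
    cong₂ lam (ren-ren ρ ρ' a) (trans (ren-ren (ext ρ) (ext ρ') m) (ren-cong (ext-∘ ρ ρ') m))
  ren-ren ρ ρ' (pi a m)  =
    cong₂ pi (ren-ren ρ ρ' a) (trans (ren-ren (ext ρ) (ext ρ') m) (ren-cong (ext-∘ ρ ρ') m))
  ren-ren ρ ρ' (sort s)  = refl

  ext-id : ∀ {ρ} → ρ ≗ id → ext ρ ≗ id
  ext-id e zero    = refl
  ext-id e (suc x) = cong suc (e x)

  ren-id : ∀ {ρ} → ρ ≗ id → ∀ t → ren ρ t ≡ t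
  ren-id e (v x)     = cong v (e x)
  ren-id e (t · u)   = cong₂ _·_ (ren-id e t) (ren-id e u)
  ren-id e (lam a m) = cong₂ lam (ren-id e a) (ren-id (ext-id e) m)
  ren-id e (pi a m)  = cong₂ pi (ren-id e a) (ren-id (ext-id e) m)
  ren-id e (sort s)  = refl

  exts-ext : ∀ σ ρ → exts σ ∘ ext ρ ≗ exts (σ ∘ ρ)
  exts-ext σ ρ zero    = refl
  exts-ext σ ρ (suc x) = refl

  sub-ren : ∀ σ ρ t → sub σ (ren ρ t) ≡ sub (σ ∘ ρ) t
  sub-ren σ ρ (v x)     = refl
  sub-ren σ ρ (t · u)   = cong₂ _·_ (sub-ren σ ρ t) (sub-ren σ ρ u)
  sub-ren σ ρ (lam a m) =
    cong₂ lam (sub-ren σ ρ a) (trans (sub-ren (exts σ) (ext ρ) m) (sub-cong (exts-ext σ ρ) m))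
  sub-ren σ ρ (pi a m)  =
    cong₂ pi (sub-ren σ ρ a) (trans (sub-ren (exts σ) (ext ρ) m) (sub-cong (exts-ext σ ρ) m))
  sub-ren σ ρ (sort s)  = refl

  ren-exts : ∀ ρ σ → ren (ext ρ) ∘ exts σ ≗ exts (ren ρ ∘ σ)
  ren-exts ρ σ zero    = refl
  ren-exts ρ σ (suc x) = trans (ren-ren (ext ρ) suc (σ x)) (sym (ren-ren suc ρ (σ x)))

  ren-sub : ∀ ρ σ t → ren ρ (sub σ t) ≡ sub (ren ρ ∘ σ) t
  ren-sub ρ σ (v x)     = refl
  ren-sub ρ σ (t · u)   = cong₂ _·_ (ren-sub ρ σ t) (ren-sub ρ σ u)
  ren-sub ρ σ (lam a m) =
    cong₂ lam (ren-sub ρ σ a) (trans (ren-sub (ext ρ) (exts σ) m) (sub-cong (ren-exts ρ σ) m))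
  ren-sub ρ σ (pi a m)  =
    cong₂ pi (ren-sub ρ σ a) (trans (ren-sub (ext ρ) (exts σ) m) (sub-cong (ren-exts ρ σ) m))
  ren-sub ρ σ (sort s)  = refl

  sub-exts : ∀ σ τ → sub (exts σ) ∘ exts τ ≗ exts (sub σ ∘ τ)
  sub-exts σ τ zero    = refl
  sub-exts σ τ (suc x) = trans (sub-ren (exts σ) suc (τ x)) (sym (ren-sub suc σ (τ x)))

  sub-sub : ∀ σ τ t → sub σ (sub τ t) ≡ sub (sub σ ∘ τ) t
  sub-sub σ τ (v x)     = refl
  sub-sub σ τ (t · u)   = cong₂ _·_ (sub-sub σ τ t) (sub-sub σ τ u)
  sub-sub σ τ (lam a m) =
    cong₂ lam (sub-sub σ τ a) (trans (sub-sub (exts σ) (exts τ) m) (sub-cong (sub-exts σ τ) m))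
  sub-sub σ τ (pi a m)  =
    cong₂ pi (sub-sub σ τ a) (trans (sub-sub (exts σ) (exts τ) m) (sub-cong (sub-exts σ τ) m))
  sub-sub σ τ (sort s)  = refl

  exts-id : ∀ {σ} → σ ≗ v → exts σ ≗ v
  exts-id e zero    = refl
  exts-id e (suc x) = cong (ren suc) (e x)

  sub-id : ∀ {σ} → σ ≗ v → ∀ t → sub σ t ≡ t
  sub-id e (v x)     = e x
  sub-id e (t · u)   = cong₂ _·_ (sub-id e t) (sub-id e u)
  sub-id e (lam a m) = cong₂ lam (sub-id e a) (sub-id (exts-id e) m)
  sub-id e (pi a m)  = cong₂ pi (sub-id e a) (sub-id (exts-id e) m)
  sub-id e (sort s)  = refl

  sub₀-wk : ∀ n t → sub₀ n (ren suc t) ≡ t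
  sub₀-wk n t = trans (sub-ren (n •_) suc t) (sub-id (λ _ → refl) t)

  sub-sub₀ : ∀ σ n m → sub σ (sub₀ n m) ≡ sub₀ (sub σ n) (sub (exts σ) m)
  sub-sub₀ σ n m =
    trans (sub-sub σ (n •_) m)
          (trans (sub-cong pointwise m) (sym (sub-sub (sub σ n •_) (exts σ) m)))
    where
    pointwise : sub σ ∘ (n •_) ≗ sub (sub σ n •_) ∘ exts σ
    pointwise zero    = refl
    pointwise (suc x) = sym (sub₀-wk (sub σ n) (σ x))

  ren-sub₀ : ∀ ρ n m → ren ρ (sub₀ n m) ≡ sub₀ (ren ρ n) (ren (ext ρ) m)
  ren-sub₀ ρ n m =
    trans (ren-sub ρ (n •_) m)
          (trans (sub-cong pointwise m) (sym (sub-ren (ren ρ n •_) (ext ρ) m)))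
    where
    pointwise : ren ρ ∘ (n •_) ≗ (ren ρ n •_) ∘ ext ρ
    pointwise zero    = refl
    pointwise (suc x) = refl

  infix 4 _⇒_ _⇒*_ _=β_

  data _⇒_ : Λ → Λ → Set where
    pvar  : ∀ {x} → v x ⇒ v x
    psort : ∀ {s} → sort s ⇒ sort s
    papp  : ∀ {t t' u u'} → t ⇒ t' → u ⇒ u' → t · u ⇒ t' · u'
    plam  : ∀ {a a' m m'} → a ⇒ a' → m ⇒ m' → lam a m ⇒ lam a' m'
    ppi   : ∀ {a a' m m'} → a ⇒ a' → m ⇒ m' → pi a m ⇒ pi a' m'
    pbeta : ∀ {a m m' n n'} → m ⇒ m' → n ⇒ n' → lam a m · n ⇒ sub₀ n' m'

  ⇒-refl : ∀ t → t ⇒ t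
  ⇒-refl (v x)     = pvar
  ⇒-refl (t · u)   = papp (⇒-refl t) (⇒-refl u)
  ⇒-refl (lam a m) = plam (⇒-refl a) (⇒-refl m)
  ⇒-refl (pi a m)  = ppi (⇒-refl a) (⇒-refl m)
  ⇒-refl (sort s)  = psort

  ≡⇒⇒ : ∀ {a b} → a ≡ b → a ⇒ b
  ≡⇒⇒ {a} refl = ⇒-refl a

  ⇒-ren : ∀ ρ {t t'} → t ⇒ t' → ren ρ t ⇒ ren ρ t'
  ⇒-ren ρ pvar       = pvar
  ⇒-ren ρ psort      = psort
  ⇒-ren ρ (papp p q) = papp (⇒-ren ρ p) (⇒-ren ρ q)
  ⇒-ren ρ (plam p q) = plam (⇒-ren ρ p) (⇒-ren (ext ρ) q)
  ⇒-ren ρ (ppi p q)  = ppi (⇒-ren ρ p) (⇒-ren (ext ρ) q)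
  ⇒-ren ρ (pbeta {m' = m'} {n' = n'} p q) =
    subst (_ ⇒_) (sym (ren-sub₀ ρ n' m')) (pbeta (⇒-ren (ext ρ) p) (⇒-ren ρ q))

  _⇛_ : Sub → Sub → Set
  σ ⇛ τ = ∀ x → σ x ⇒ τ x

  ⇛-exts : ∀ {σ τ} → σ ⇛ τ → exts σ ⇛ exts τ
  ⇛-exts e zero    = pvar
  ⇛-exts e (suc x) = ⇒-ren suc (e x)

  ⇒-sub : ∀ {σ τ t t'} → σ ⇛ τ → t ⇒ t' → sub σ t ⇒ sub τ t'
  ⇒-sub e (pvar {x}) = e x
  ⇒-sub e psort      = psort
  ⇒-sub e (papp p q) = papp (⇒-sub e p) (⇒-sub e q)
  ⇒-sub e (plam p q) = plam (⇒-sub e p) (⇒-sub (⇛-exts e) q)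
  ⇒-sub e (ppi p q)  = ppi (⇒-sub e p) (⇒-sub (⇛-exts e) q)
  ⇒-sub {τ = τ} e (pbeta {m' = m'} {n' = n'} p q) =
    subst (_ ⇒_) (sym (sub-sub₀ τ n' m')) (pbeta (⇒-sub (⇛-exts e) p) (⇒-sub e q))

  ⇒-sub₀ : ∀ {n n' m m'} → m ⇒ m' → n ⇒ n' → sub₀ n m ⇒ sub₀ n' m'
  ⇒-sub₀ p q = ⇒-sub (λ { zero → q ; (suc x) → pvar }) p

  -- The complete development contracts every redex of a term at once; any
  -- parallel reduct of t reduces in parallel to it (the triangle property).
  develop : Λ → Λ
  develop (v x)          = v x
  develop (lam a m · n)  = sub₀ (develop n) (develop m)
  develop (v x · u)      = v x · develop u
  develop ((t · t') · u) = develop (t · t') · develop u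
  develop (pi a b · u)   = develop (pi a b) · develop u
  develop (sort s · u)   = sort s · develop u
  develop (lam a m)      = lam (develop a) (develop m)
  develop (pi a m)       = pi (develop a) (develop m)
  develop (sort s)       = sort s

  triangle : ∀ {t t'} → t ⇒ t' → t' ⇒ develop t
  triangle pvar                             = pvar
  triangle psort                            = psort
  triangle (papp {v x} pvar q)              = papp pvar (triangle q)
  triangle (papp {t · t'} p q)              = papp (triangle p) (triangle q)
  triangle (papp {pi a b} p q)              = papp (triangle p) (triangle q)
  triangle (papp {sort s} psort q)          = papp psort (triangle q)
  triangle (papp {lam a m} (plam p p') q)   = pbeta (triangle p') (triangle q)
  triangle (plam p q)                       = plam (triangle p) (triangle q)
  triangle (ppi p q)                        = ppi (triangle p) (triangle q)
  triangle (pbeta p q)                      = ⇒-sub₀ (triangle p) (triangle q)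

  _⇒*_ : Λ → Λ → Set
  _⇒*_ = Star _⇒_

  _=β_ : Λ → Λ → Set
  _=β_ = EqClosure _⇒_

  strip : ∀ {t a b} → t ⇒ a → t ⇒* b → Σ Λ λ w → (a ⇒* w) × (b ⇒ w)
  strip {a = a} p ε = a , ε , p
  strip p (q ◅ qs) with strip (triangle q) qs
  ... | w , aw , bw = w , triangle p ◅ aw , bw

  confluence : ∀ {t a b} → t ⇒* a → t ⇒* b → Σ Λ λ w → (a ⇒* w) × (b ⇒* w)
  confluence {b = b} ε q = b , q , ε
  confluence (p ◅ ps) q with strip p q
  ... | w , aw , bw with confluence ps aw
  ... | w' , aw' , ww' = w' , aw' , bw ◅ ww'

  church-rosser : ∀ {t u} → t =β u → Σ Λ λ w → (t ⇒* w) × (u ⇒* w)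
  church-rosser {t} ε = t , ε , ε
  church-rosser (fwd p ◅ ps) with church-rosser ps
  ... | w , tw , uw = w , p ◅ tw , uw
  church-rosser (bwd p ◅ ps) with church-rosser ps
  ... | w , tw , uw with confluence (p ◅ ε) tw
  ... | w' , ww' , tw' = w' , ww' , uw ◅◅ tw'

  ⇒*-to-=β : ∀ {t u} → t ⇒* u → t =β u
  ⇒*-to-=β ε        = ε
  ⇒*-to-=β (p ◅ ps) = fwd p ◅ ⇒*-to-=β ps

  -- Reducts of Π-types and of sorts keep their shape, so by Church–Rosser
  -- Π is injective and sorts are injective up to β-conversion.
  pi-reducts : ∀ {a b w} → pi a b ⇒* w → Σ Λ λ a' → Σ Λ λ b' → (w ≡ pi a' b') × (a ⇒* a') × (b ⇒* b')
  pi-reducts {a} {b} ε = a , b , refl , ε , ε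
  pi-reducts (ppi p q ◅ ps) with pi-reducts ps
  ... | a' , b' , refl , aa' , bb' = a' , b' , refl , p ◅ aa' , q ◅ bb'

  sort-reducts : ∀ {s w} → sort s ⇒* w → w ≡ sort s
  sort-reducts ε            = refl
  sort-reducts (psort ◅ ps) = sort-reducts ps

  pi-injective : ∀ {a b a' b'} → pi a b =β pi a' b' → (a =β a') × (b =β b')
  pi-injective c with church-rosser c
  ... | w , x , y with pi-reducts x | pi-reducts y
  ... | _ , _ , refl , xa , xb | _ , _ , refl , ya , yb =
    ⇒*-to-=β xa ◅◅ EqClosure.symmetric _⇒_ (⇒*-to-=β ya) ,
    ⇒*-to-=β xb ◅◅ EqClosure.symmetric _⇒_ (⇒*-to-=β yb)

  sort-injective : ∀ {s s'} → sort s =β sort s' → s ≡ s'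
  sort-injective c with church-rosser c
  ... | w , x , y with sort-reducts x | sort-reducts y
  ... | refl | refl = refl

cong₃ : ∀ {A B C D : Set} (f : A → B → C → D) {a a' b b' c c'} →
        a ≡ a' → b ≡ b' → c ≡ c' → f a b c ≡ f a' b' c'
cong₃ f refl refl refl = refl

module Renaming {S : Set} (Ax : S → S → Set) (Rl : S → S → S → Set) where

  open PTSC Ax Rl

  lift-cong : ∀ {ρ ρ'} → ρ ≗ ρ' → lift ρ ≗ lift ρ'
  lift-cong e zero    = refl
  lift-cong e (suc x) = cong suc (e x)

  mutual
    renT-cong : ∀ {ρ ρ'} → ρ ≗ ρ' → renT ρ ≗ renT ρ'
    renT-cong e (Π A B)      = cong₂ Π (renT-cong e A) (renT-cong (lift-cong e) B)
    renT-cong e (ƛ A M)      = cong₂ ƛ (renT-cong e A) (renT-cong (lift-cong e) M)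
    renT-cong e (srt s)      = refl
    renT-cong e (var x l)    = cong₂ var (e x) (renL-cong e l)
    renT-cong e (app M l)    = cong₂ app (renT-cong e M) (renL-cong e l)
    renT-cong e (esub N A M) =
      cong₃ esub (renT-cong e N) (renT-cong e A) (renT-cong (lift-cong e) M)

    renL-cong : ∀ {ρ ρ'} → ρ ≗ ρ' → renL ρ ≗ renL ρ'
    renL-cong e nil           = refl
    renL-cong e (M ∷ₗ l)      = cong₂ _∷ₗ_ (renT-cong e M) (renL-cong e l)
    renL-cong e (l ++ₗ l')    = cong₂ _++ₗ_ (renL-cong e l) (renL-cong e l')
    renL-cong e (esubₗ N A l) =
      cong₃ esubₗ (renT-cong e N) (renT-cong e A) (renL-cong (lift-cong e) l)

  lift-∘ : ∀ ρ ρ' → lift ρ ∘ lift ρ' ≗ lift (ρ ∘ ρ')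
  lift-∘ ρ ρ' zero    = refl
  lift-∘ ρ ρ' (suc x) = refl

  mutual
    renT-renT : ∀ ρ ρ' M → renT ρ (renT ρ' M) ≡ renT (ρ ∘ ρ') M
    renT-renT ρ ρ' (Π A B)      = cong₂ Π (renT-renT ρ ρ' A) (renT-renT-lift ρ ρ' B)
    renT-renT ρ ρ' (ƛ A M)      = cong₂ ƛ (renT-renT ρ ρ' A) (renT-renT-lift ρ ρ' M)
    renT-renT ρ ρ' (srt s)      = refl
    renT-renT ρ ρ' (var x l)    = cong (var _) (renL-renL ρ ρ' l)
    renT-renT ρ ρ' (app M l)    = cong₂ app (renT-renT ρ ρ' M) (renL-renL ρ ρ' l)
    renT-renT ρ ρ' (esub N A M) =
      cong₃ esub (renT-renT ρ ρ' N) (renT-renT ρ ρ' A) (renT-renT-lift ρ ρ' M)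

    renT-renT-lift : ∀ ρ ρ' M → renT (lift ρ) (renT (lift ρ') M) ≡ renT (lift (ρ ∘ ρ')) M
    renT-renT-lift ρ ρ' M = trans (renT-renT (lift ρ) (lift ρ') M) (renT-cong (lift-∘ ρ ρ') M)

    renL-renL : ∀ ρ ρ' l → renL ρ (renL ρ' l) ≡ renL (ρ ∘ ρ') l
    renL-renL ρ ρ' nil           = refl
    renL-renL ρ ρ' (M ∷ₗ l)      = cong₂ _∷ₗ_ (renT-renT ρ ρ' M) (renL-renL ρ ρ' l)
    renL-renL ρ ρ' (l ++ₗ l')    = cong₂ _++ₗ_ (renL-renL ρ ρ' l) (renL-renL ρ ρ' l')
    renL-renL ρ ρ' (esubₗ N A l) =
      cong₃ esubₗ (renT-renT ρ ρ' N) (renT-renT ρ ρ' A)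
            (trans (renL-renL (lift ρ) (lift ρ') l) (renL-cong (lift-∘ ρ ρ') l))

  lift-id : ∀ {ρ} → ρ ≗ id → lift ρ ≗ id
  lift-id e zero    = refl
  lift-id e (suc x) = cong suc (e x)

  mutual
    renT-id : ∀ {ρ} → ρ ≗ id → ∀ M → renT ρ M ≡ M
    renT-id e (Π A B)      = cong₂ Π (renT-id e A) (renT-id (lift-id e) B)
    renT-id e (ƛ A M)      = cong₂ ƛ (renT-id e A) (renT-id (lift-id e) M)
    renT-id e (srt s)      = refl
    renT-id e (var x l)    = cong₂ var (e x) (renL-id e l)
    renT-id e (app M l)    = cong₂ app (renT-id e M) (renL-id e l)
    renT-id e (esub N A M) = cong₃ esub (renT-id e N) (renT-id e A) (renT-id (lift-id e) M)

    renL-id : ∀ {ρ} → ρ ≗ id → ∀ l → renL ρ l ≡ l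
    renL-id e nil           = refl
    renL-id e (M ∷ₗ l)      = cong₂ _∷ₗ_ (renT-id e M) (renL-id e l)
    renL-id e (l ++ₗ l')    = cong₂ _++ₗ_ (renL-id e l) (renL-id e l')
    renL-id e (esubₗ N A l) = cong₃ esubₗ (renT-id e N) (renT-id e A) (renL-id (lift-id e) l)

  renT-id′ : ∀ M → renT id M ≡ M
  renT-id′ = renT-id (λ _ → refl)

  -- Renamings commute with weakening and with the binder exchange swap01;
  -- together these say that renaming commutes with the body produced by the
  -- rules σ-ƛ and σ-Π.
  wk-renT : ∀ ρ N → wk (renT ρ N) ≡ renT (lift ρ) (wk N)
  wk-renT ρ N = trans (renT-renT suc ρ N) (sym (renT-renT (lift ρ) suc N))

  swap01-lift² : ∀ ρ → swap01 ∘ lift (lift ρ) ≗ lift (lift ρ) ∘ swap01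
  swap01-lift² ρ zero          = refl
  swap01-lift² ρ (suc zero)    = refl
  swap01-lift² ρ (suc (suc x)) = refl

  renT-σ-body : ∀ ρ N A C →
    esub (wk (renT ρ N)) (wk (renT ρ A)) (renT swap01 (renT (lift (lift ρ)) C))
      ≡ renT (lift ρ) (esub (wk N) (wk A) (renT swap01 C))
  renT-σ-body ρ N A C =
    cong₃ esub (wk-renT ρ N) (wk-renT ρ A)
      (trans (renT-renT swap01 (lift (lift ρ)) C)
        (trans (renT-cong (swap01-lift² ρ) C) (sym (renT-renT (lift (lift ρ)) swap01 C))))

  mv-zero : ∀ j x → mv j x ≡ zero → x ≡ j
  mv-zero zero    x       e = e
  mv-zero (suc j) (suc x) e with mv j x in eq
  ... | zero = cong suc (mv-zero j x eq)

  mv-above : ∀ j k → mv j (suc (j + k)) ≡ suc (j + k)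
  mv-above zero    k = refl
  mv-above (suc j) k = cong bump (mv-above j k)

  swap01-lift-mv : ∀ j → swap01 ∘ lift (mv j) ≗ mv (suc j)
  swap01-lift-mv j zero    = refl
  swap01-lift-mv j (suc x) with mv j x
  ... | zero  = refl
  ... | suc m = refl

  lift-suc-mv : ∀ j x → lift suc (mv j x) ≡ mv (suc j) (suc x)
  lift-suc-mv j x with mv j x
  ... | zero  = refl
  ... | suc m = refl

  esubAt-under-binder : ∀ j P A E →
    esub (wk (renT (j +_) P)) (wk (renT (j +_) A)) (renT swap01 (renT (lift (mv j)) E))
      ≡ esubAt (suc j) P A E
  esubAt-under-binder j P A E =
    cong₃ esub (renT-renT suc (j +_) P) (renT-renT suc (j +_) A)
      (trans (renT-renT swap01 (lift (mv j)) E) (renT-cong (swap01-lift-mv j) E))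

  wk-esubAt : ∀ j P A X → wk (esubAt j P A X) ≡ esubAt (suc j) P A (wk X)
  wk-esubAt j P A X =
    cong₃ esub (renT-renT suc (j +_) P) (renT-renT suc (j +_) A)
      (trans (renT-renT (lift suc) (mv j) X)
        (trans (renT-cong (lift-suc-mv j) X) (sym (renT-renT (mv (suc j)) suc X))))

-- The typing rules Cut₂/Cut₄ conclude with a
-- renamed term renT ρ X, so subject reduction must analyse steps of such
-- terms; every one of them is the image of a step of X at the same depth.

module StepsOfRenamings {S : Set} (Ax : S → S → Set) (Rl : S → S → S → Set) where

  open PTSC Ax Rl
  open Renaming Ax Rl

  mutual
    depth : ∀ {M M'} → M ⟶ M' → ℕ
    depth (Π₁ r)    = suc (depth r)
    depth (Π₂ r)    = suc (depth r)
    depth (ƛ₁ r)    = suc (depth r)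
    depth (ƛ₂ r)    = suc (depth r)
    depth (var₁ r)  = suc (depthₗ r)
    depth (app₁ r)  = suc (depth r)
    depth (app₂ r)  = suc (depthₗ r)
    depth (esub₁ r) = suc (depth r)
    depth (esub₂ r) = suc (depth r)
    depth (esub₃ r) = suc (depth r)
    depth _         = zero

    depthₗ : ∀ {l l'} → l ⟶ₗ l' → ℕ
    depthₗ (cons₁ r)  = suc (depth r)
    depthₗ (cons₂ r)  = suc (depthₗ r)
    depthₗ (cat₁ r)   = suc (depthₗ r)
    depthₗ (cat₂ r)   = suc (depthₗ r)
    depthₗ (esubₗ₁ r) = suc (depth r)
    depthₗ (esubₗ₂ r) = suc (depth r)
    depthₗ (esubₗ₃ r) = suc (depthₗ r)
    depthₗ _          = zero

  record Preimage (ρ : ℕ → ℕ) (M : Tm) {Z Y : Tm} (r : Z ⟶ Y) : Set where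
    constructor preimage
    field
      {reduct} : Tm
      step     : M ⟶ reduct
      image    : Y ≡ renT ρ reduct
      depth≡   : depth step ≡ depth r

  record Preimageₗ (ρ : ℕ → ℕ) (l : Lst) {Z Y : Lst} (r : Z ⟶ₗ Y) : Set where
    constructor preimage
    field
      {reduct} : Lst
      step     : l ⟶ₗ reduct
      image    : Y ≡ renL ρ reduct
      depth≡   : depthₗ step ≡ depthₗ r

  -- By induction on the step; the equation renT ρ M ≡ Z lets us match on the
  -- step first and then read off the shape of M.
  mutual
    reflect : ∀ ρ {Z Y} (r : Z ⟶ Y) M → renT ρ M ≡ Z → Preimage ρ M r
    reflect ρ β       (app (ƛ A M) (N ∷ₗ l)) refl = preimage β refl refl
    reflect ρ app-nil (app M nil)             refl = preimage app-nil refl refl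
    reflect ρ app-var (app (var x l) l')      refl = preimage app-var refl refl
    reflect ρ app-app (app (app M l) l')      refl = preimage app-app refl refl
    reflect ρ σ-ƛ     (esub P G (ƛ A M))      refl =
      preimage σ-ƛ (cong (ƛ _) (renT-σ-body ρ P G M)) refl
    reflect ρ σ-var₀  (esub P G (var zero l)) refl = preimage σ-var₀ refl refl
    reflect ρ σ-varₛ  (esub P G (var (suc x) l)) refl = preimage σ-varₛ refl refl
    reflect ρ σ-app   (esub P G (app M l))    refl = preimage σ-app refl refl
    reflect ρ σ-Π     (esub P G (Π A B))      refl =
      preimage σ-Π (cong (Π _) (renT-σ-body ρ P G B)) refl
    reflect ρ σ-srt   (esub P G (srt s))      refl = preimage σ-srt refl refl
    reflect ρ (Π₁ r) (Π A B) refl with reflect ρ r A refl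
    ... | preimage s refl d = preimage (Π₁ s) refl (cong suc d)
    reflect ρ (Π₂ r) (Π A B) refl with reflect (lift ρ) r B refl
    ... | preimage s refl d = preimage (Π₂ s) refl (cong suc d)
    reflect ρ (ƛ₁ r) (ƛ A M) refl with reflect ρ r A refl
    ... | preimage s refl d = preimage (ƛ₁ s) refl (cong suc d)
    reflect ρ (ƛ₂ r) (ƛ A M) refl with reflect (lift ρ) r M refl
    ... | preimage s refl d = preimage (ƛ₂ s) refl (cong suc d)
    reflect ρ (var₁ r) (var x l) refl with reflectₗ ρ r l refl
    ... | preimage s refl d = preimage (var₁ s) refl (cong suc d)
    reflect ρ (app₁ r) (app M l) refl with reflect ρ r M refl
    ... | preimage s refl d = preimage (app₁ s) refl (cong suc d)
    reflect ρ (app₂ r) (app M l) refl with reflectₗ ρ r l refl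
    ... | preimage s refl d = preimage (app₂ s) refl (cong suc d)
    reflect ρ (esub₁ r) (esub N A M) refl with reflect ρ r N refl
    ... | preimage s refl d = preimage (esub₁ s) refl (cong suc d)
    reflect ρ (esub₂ r) (esub N A M) refl with reflect ρ r A refl
    ... | preimage s refl d = preimage (esub₂ s) refl (cong suc d)
    reflect ρ (esub₃ r) (esub N A M) refl with reflect (lift ρ) r M refl
    ... | preimage s refl d = preimage (esub₃ s) refl (cong suc d)

    reflectₗ : ∀ ρ {Z Y} (r : Z ⟶ₗ Y) l → renL ρ l ≡ Z → Preimageₗ ρ l r
    reflectₗ ρ cat-cons  ((M ∷ₗ l) ++ₗ l')   refl = preimage cat-cons refl refl
    reflectₗ ρ cat-nil   (nil ++ₗ l)         refl = preimage cat-nil refl refl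
    reflectₗ ρ cat-assoc ((l ++ₗ l') ++ₗ l'') refl = preimage cat-assoc refl refl
    reflectₗ ρ cat-nilʳ  (l ++ₗ nil)         refl = preimage cat-nilʳ refl refl
    reflectₗ ρ σ-nil     (esubₗ P G nil)      refl = preimage σ-nil refl refl
    reflectₗ ρ σ-cons    (esubₗ P G (M ∷ₗ l)) refl = preimage σ-cons refl refl
    reflectₗ ρ σ-cat     (esubₗ P G (l ++ₗ l')) refl = preimage σ-cat refl refl
    reflectₗ ρ (cons₁ r) (M ∷ₗ l) refl with reflect ρ r M refl
    ... | preimage s refl d = preimage (cons₁ s) refl (cong suc d)
    reflectₗ ρ (cons₂ r) (M ∷ₗ l) refl with reflectₗ ρ r l refl
    ... | preimage s refl d = preimage (cons₂ s) refl (cong suc d)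
    reflectₗ ρ (cat₁ r) (l ++ₗ l') refl with reflectₗ ρ r l refl
    ... | preimage s refl d = preimage (cat₁ s) refl (cong suc d)
    reflectₗ ρ (cat₂ r) (l ++ₗ l') refl with reflectₗ ρ r l' refl
    ... | preimage s refl d = preimage (cat₂ s) refl (cong suc d)
    reflectₗ ρ (esubₗ₁ r) (esubₗ N A l) refl with reflect ρ r N refl
    ... | preimage s refl d = preimage (esubₗ₁ s) refl (cong suc d)
    reflectₗ ρ (esubₗ₂ r) (esubₗ N A l) refl with reflect ρ r A refl
    ... | preimage s refl d = preimage (esubₗ₂ s) refl (cong suc d)
    reflectₗ ρ (esubₗ₃ r) (esubₗ N A l) refl with reflectₗ (lift ρ) r l refl
    ... | preimage s refl d = preimage (esubₗ₃ s) refl (cong suc d)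

module Conversion {S : Set} (Ax : S → S → Set) (Rl : S → S → S → Set) where

  open PTSC Ax Rl
  open Lambda S

  infix 4 _↔ₗ*_ _⇒ₗ_

  _↔ₗ*_ : Lst → Lst → Set
  _↔ₗ*_ = EqClosure _⟶ₗ_

  ↔*-step : ∀ {M M'} → M ⟶ M' → M ↔* M'
  ↔*-step = EqClosure.return

  ↔ₗ*-step : ∀ {l l'} → l ⟶ₗ l' → l ↔ₗ* l'
  ↔ₗ*-step = EqClosure.return

  ≡→↔* : ∀ {M M'} → M ≡ M' → M ↔* M'
  ≡→↔* refl = ε

  ↔*-sym : ∀ {M M'} → M ↔* M' → M' ↔* M
  ↔*-sym = EqClosure.symmetric _⟶_

  spine : Λ → List Λ → Λ
  spine t []       = t
  spine t (u ∷ us) = spine (t · u) us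

  mutual
    ⟦_⟧ : Tm → Λ
    ⟦ Π A B ⟧      = pi ⟦ A ⟧ ⟦ B ⟧
    ⟦ ƛ A M ⟧      = lam ⟦ A ⟧ ⟦ M ⟧
    ⟦ srt s ⟧      = sort s
    ⟦ var x l ⟧    = spine (v x) ⟦ l ⟧ₗ
    ⟦ app M l ⟧    = spine ⟦ M ⟧ ⟦ l ⟧ₗ
    ⟦ esub N A M ⟧ = sub₀ ⟦ N ⟧ ⟦ M ⟧

    ⟦_⟧ₗ : Lst → List Λ
    ⟦ nil ⟧ₗ         = []
    ⟦ M ∷ₗ l ⟧ₗ      = ⟦ M ⟧ ∷ ⟦ l ⟧ₗ
    ⟦ l ++ₗ l' ⟧ₗ    = ⟦ l ⟧ₗ ++ ⟦ l' ⟧ₗ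
    ⟦ esubₗ N A l ⟧ₗ = map (sub₀ ⟦ N ⟧) ⟦ l ⟧ₗ

  spine-++ : ∀ t us vs → spine t (us ++ vs) ≡ spine (spine t us) vs
  spine-++ t []       vs = refl
  spine-++ t (u ∷ us) vs = spine-++ (t · u) us vs

  sub-spine : ∀ σ t us → sub σ (spine t us) ≡ spine (sub σ t) (map (sub σ) us)
  sub-spine σ t []       = refl
  sub-spine σ t (u ∷ us) = sub-spine σ (t · u) us

  ren-spine : ∀ ρ t us → ren ρ (spine t us) ≡ spine (ren ρ t) (map (ren ρ) us)
  ren-spine ρ t []       = refl
  ren-spine ρ t (u ∷ us) = ren-spine ρ (t · u) us

  lift≗ext : ∀ ρ → lift ρ ≗ ext ρ
  lift≗ext ρ zero    = refl
  lift≗ext ρ (suc x) = refl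

  mutual
    ⟦renT⟧ : ∀ ρ M → ⟦ renT ρ M ⟧ ≡ ren ρ ⟦ M ⟧
    ⟦renT⟧ ρ (Π A B)      = cong₂ pi (⟦renT⟧ ρ A) (⟦renT-lift⟧ ρ B)
    ⟦renT⟧ ρ (ƛ A M)      = cong₂ lam (⟦renT⟧ ρ A) (⟦renT-lift⟧ ρ M)
    ⟦renT⟧ ρ (srt s)      = refl
    ⟦renT⟧ ρ (var x l)    =
      trans (cong (spine (v (ρ x))) (⟦renL⟧ ρ l)) (sym (ren-spine ρ (v x) ⟦ l ⟧ₗ))
    ⟦renT⟧ ρ (app M l)    =
      trans (cong₂ spine (⟦renT⟧ ρ M) (⟦renL⟧ ρ l)) (sym (ren-spine ρ ⟦ M ⟧ ⟦ l ⟧ₗ))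
    ⟦renT⟧ ρ (esub N A M) =
      trans (cong₂ sub₀ (⟦renT⟧ ρ N) (⟦renT-lift⟧ ρ M)) (sym (ren-sub₀ ρ ⟦ N ⟧ ⟦ M ⟧))

    ⟦renT-lift⟧ : ∀ ρ M → ⟦ renT (lift ρ) M ⟧ ≡ ren (ext ρ) ⟦ M ⟧
    ⟦renT-lift⟧ ρ M = trans (⟦renT⟧ (lift ρ) M) (ren-cong (lift≗ext ρ) ⟦ M ⟧)

    ⟦renL⟧ : ∀ ρ l → ⟦ renL ρ l ⟧ₗ ≡ map (ren ρ) ⟦ l ⟧ₗ
    ⟦renL⟧ ρ nil           = refl
    ⟦renL⟧ ρ (M ∷ₗ l)      = cong₂ _∷_ (⟦renT⟧ ρ M) (⟦renL⟧ ρ l)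
    ⟦renL⟧ ρ (l ++ₗ l')    =
      trans (cong₂ _++_ (⟦renL⟧ ρ l) (⟦renL⟧ ρ l')) (sym (map-++ (ren ρ) ⟦ l ⟧ₗ ⟦ l' ⟧ₗ))
    ⟦renL⟧ ρ (esubₗ N A l) = begin
      map (sub₀ ⟦ renT ρ N ⟧) ⟦ renL (lift ρ) l ⟧ₗ
        ≡⟨ cong₂ (λ n us → map (sub₀ n) us) (⟦renT⟧ ρ N)
                 (trans (⟦renL⟧ (lift ρ) l) (map-cong (ren-cong (lift≗ext ρ)) ⟦ l ⟧ₗ)) ⟩
      map (sub₀ (ren ρ ⟦ N ⟧)) (map (ren (ext ρ)) ⟦ l ⟧ₗ)
        ≡⟨ sym (map-∘ ⟦ l ⟧ₗ) ⟩
      map (sub₀ (ren ρ ⟦ N ⟧) ∘ ren (ext ρ)) ⟦ l ⟧ₗ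
        ≡⟨ map-cong (λ t → sym (ren-sub₀ ρ ⟦ N ⟧ t)) ⟦ l ⟧ₗ ⟩
      map (ren ρ ∘ sub₀ ⟦ N ⟧) ⟦ l ⟧ₗ
        ≡⟨ map-∘ ⟦ l ⟧ₗ ⟩
      map (ren ρ) (map (sub₀ ⟦ N ⟧) ⟦ l ⟧ₗ) ∎
      where open ≡-Reasoning

  data _⇒ₗ_ : List Λ → List Λ → Set where
    []  : [] ⇒ₗ []
    _∷_ : ∀ {t t' us us'} → t ⇒ t' → us ⇒ₗ us' → (t ∷ us) ⇒ₗ (t' ∷ us')

  ⇒ₗ-refl : ∀ us → us ⇒ₗ us
  ⇒ₗ-refl []       = []
  ⇒ₗ-refl (u ∷ us) = ⇒-refl u ∷ ⇒ₗ-refl us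

  ≡⇒⇒ₗ : ∀ {us us'} → us ≡ us' → us ⇒ₗ us'
  ≡⇒⇒ₗ {us} refl = ⇒ₗ-refl us

  ⇒ₗ-++ : ∀ {us us' ws ws'} → us ⇒ₗ us' → ws ⇒ₗ ws' → (us ++ ws) ⇒ₗ (us' ++ ws')
  ⇒ₗ-++ []       q = q
  ⇒ₗ-++ (p ∷ ps) q = p ∷ ⇒ₗ-++ ps q

  ⇒ₗ-sub₀ : ∀ {n n' us us'} → n ⇒ n' → us ⇒ₗ us' → map (sub₀ n) us ⇒ₗ map (sub₀ n') us'
  ⇒ₗ-sub₀ p []       = []
  ⇒ₗ-sub₀ p (q ∷ qs) = ⇒-sub₀ q p ∷ ⇒ₗ-sub₀ p qs

  ⇒-spine : ∀ {t t' us us'} → t ⇒ t' → us ⇒ₗ us' → spine t us ⇒ spine t' us'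
  ⇒-spine p []       = p
  ⇒-spine p (q ∷ qs) = ⇒-spine (papp p q) qs

  sub₀-swap : ∀ p m → sub₀ (ren suc p) (ren swap01 m) ≡ sub (exts (p •_)) m
  sub₀-swap p m = trans (sub-ren (ren suc p •_) swap01 m) (sub-cong pointwise m)
    where
    pointwise : ∀ y → (ren suc p • swap01 y) ≡ exts (p •_) y
    pointwise zero          = refl
    pointwise (suc zero)    = refl
    pointwise (suc (suc y)) = refl

  ⟦σ-body⟧ : ∀ P G M → ⟦ esub (wk P) (wk G) (renT swap01 M) ⟧ ≡ sub (exts (⟦ P ⟧ •_)) ⟦ M ⟧
  ⟦σ-body⟧ P G M = trans (cong₂ sub₀ (⟦renT⟧ suc P) (⟦renT⟧ swap01 M)) (sub₀-swap ⟦ P ⟧ ⟦ M ⟧)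

  mutual
    ⟦⟶⟧ : ∀ {M M'} → M ⟶ M' → ⟦ M ⟧ ⇒ ⟦ M' ⟧
    ⟦⟶⟧ (β {M = M} {N} {l}) = ⇒-spine (pbeta (⇒-refl ⟦ M ⟧) (⇒-refl ⟦ N ⟧)) (⇒ₗ-refl ⟦ l ⟧ₗ)
    ⟦⟶⟧ app-nil                     = ⇒-refl _
    ⟦⟶⟧ (app-var {x} {l} {l'})      = ≡⇒⇒ (sym (spine-++ (v x) ⟦ l ⟧ₗ ⟦ l' ⟧ₗ))
    ⟦⟶⟧ (app-app {M} {l} {l'})      = ≡⇒⇒ (sym (spine-++ ⟦ M ⟧ ⟦ l ⟧ₗ ⟦ l' ⟧ₗ))
    ⟦⟶⟧ (σ-ƛ {P} {G} {A} {M})       = plam (⇒-refl _) (≡⇒⇒ (sym (⟦σ-body⟧ P G M)))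
    ⟦⟶⟧ (σ-var₀ {P} {G} {l})        = ≡⇒⇒ (sub-spine (⟦ P ⟧ •_) (v zero) ⟦ l ⟧ₗ)
    ⟦⟶⟧ (σ-varₛ {P} {G} {x} {l})    = ≡⇒⇒ (sub-spine (⟦ P ⟧ •_) (v (suc x)) ⟦ l ⟧ₗ)
    ⟦⟶⟧ (σ-app {P} {G} {M} {l})     = ≡⇒⇒ (sub-spine (⟦ P ⟧ •_) ⟦ M ⟧ ⟦ l ⟧ₗ)
    ⟦⟶⟧ (σ-Π {P} {G} {A} {B})       = ppi (⇒-refl _) (≡⇒⇒ (sym (⟦σ-body⟧ P G B)))
    ⟦⟶⟧ σ-srt                       = psort
    ⟦⟶⟧ (Π₁ r)                      = ppi (⟦⟶⟧ r) (⇒-refl _)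
    ⟦⟶⟧ (Π₂ r)                      = ppi (⇒-refl _) (⟦⟶⟧ r)
    ⟦⟶⟧ (ƛ₁ r)                      = plam (⟦⟶⟧ r) (⇒-refl _)
    ⟦⟶⟧ (ƛ₂ r)                      = plam (⇒-refl _) (⟦⟶⟧ r)
    ⟦⟶⟧ (var₁ r)                    = ⇒-spine pvar (⟦⟶ₗ⟧ r)
    ⟦⟶⟧ (app₁ {l = l} r)            = ⇒-spine (⟦⟶⟧ r) (⇒ₗ-refl ⟦ l ⟧ₗ)
    ⟦⟶⟧ (app₂ {M} r)                = ⇒-spine (⇒-refl ⟦ M ⟧) (⟦⟶ₗ⟧ r)
    ⟦⟶⟧ (esub₁ {M = M} r)           = ⇒-sub₀ (⇒-refl ⟦ M ⟧) (⟦⟶⟧ r)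
    ⟦⟶⟧ (esub₂ r)                   = ⇒-refl _
    ⟦⟶⟧ (esub₃ {N} r)               = ⇒-sub₀ (⟦⟶⟧ r) (⇒-refl ⟦ N ⟧)

    ⟦⟶ₗ⟧ : ∀ {l l'} → l ⟶ₗ l' → ⟦ l ⟧ₗ ⇒ₗ ⟦ l' ⟧ₗ
    ⟦⟶ₗ⟧ cat-cons                    = ⇒ₗ-refl _
    ⟦⟶ₗ⟧ cat-nil                     = ⇒ₗ-refl _
    ⟦⟶ₗ⟧ (cat-assoc {l} {l'} {l''})  = ≡⇒⇒ₗ (++-assoc ⟦ l ⟧ₗ ⟦ l' ⟧ₗ ⟦ l'' ⟧ₗ)
    ⟦⟶ₗ⟧ (cat-nilʳ {l})              = ≡⇒⇒ₗ (++-identityʳ ⟦ l ⟧ₗ)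
    ⟦⟶ₗ⟧ σ-nil                       = []
    ⟦⟶ₗ⟧ σ-cons                      = ⇒ₗ-refl _
    ⟦⟶ₗ⟧ (σ-cat {P} {G} {l} {l'})    = ≡⇒⇒ₗ (map-++ (sub₀ ⟦ P ⟧) ⟦ l ⟧ₗ ⟦ l' ⟧ₗ)
    ⟦⟶ₗ⟧ (cons₁ {l = l} r)           = ⟦⟶⟧ r ∷ ⇒ₗ-refl ⟦ l ⟧ₗ
    ⟦⟶ₗ⟧ (cons₂ r)                   = ⇒-refl _ ∷ ⟦⟶ₗ⟧ r
    ⟦⟶ₗ⟧ (cat₁ {l₂ = l₂} r)          = ⇒ₗ-++ (⟦⟶ₗ⟧ r) (⇒ₗ-refl ⟦ l₂ ⟧ₗ)
    ⟦⟶ₗ⟧ (cat₂ {l₁} r)               = ⇒ₗ-++ (⇒ₗ-refl ⟦ l₁ ⟧ₗ) (⟦⟶ₗ⟧ r)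
    ⟦⟶ₗ⟧ (esubₗ₁ {l = l} r)          = ⇒ₗ-sub₀ (⟦⟶⟧ r) (⇒ₗ-refl ⟦ l ⟧ₗ)
    ⟦⟶ₗ⟧ (esubₗ₂ r)                  = ⇒ₗ-refl _
    ⟦⟶ₗ⟧ (esubₗ₃ {N} r)              = ⇒ₗ-sub₀ (⇒-refl ⟦ N ⟧) (⟦⟶ₗ⟧ r)

  ↔*-to-=β : ∀ {A B} → A ↔* B → ⟦ A ⟧ =β ⟦ B ⟧
  ↔*-to-=β = gmap ⟦_⟧ ⟦⟶⟧

  -- Completeness: reading a λ-term back as a PTSC term (application as a
  -- one-element spine) every term is convertible to the read-back of its
  -- translation, and parallel β-steps become conversions.
  ⌊_⌋ : Λ → Tm
  ⌊ v x ⌋     = var x nil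
  ⌊ t · u ⌋   = app ⌊ t ⌋ (⌊ u ⌋ ∷ₗ nil)
  ⌊ lam a m ⌋ = ƛ ⌊ a ⌋ ⌊ m ⌋
  ⌊ pi a m ⌋  = Π ⌊ a ⌋ ⌊ m ⌋
  ⌊ sort s ⌋  = srt s

  ⌊_⌋ₗ : List Λ → Lst
  ⌊ [] ⌋ₗ     = nil
  ⌊ u ∷ us ⌋ₗ = ⌊ u ⌋ ∷ₗ ⌊ us ⌋ₗ

  renT-⌊⌋ : ∀ ρ t → renT ρ ⌊ t ⌋ ≡ ⌊ ren ρ t ⌋
  renT-⌊⌋ ρ (v x)     = refl
  renT-⌊⌋ ρ (t · u)   = cong₂ (λ a b → app a (b ∷ₗ nil)) (renT-⌊⌋ ρ t) (renT-⌊⌋ ρ u)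
  renT-⌊⌋ ρ (lam a m) =
    cong₂ ƛ (renT-⌊⌋ ρ a) (trans (renT-⌊⌋ (lift ρ) m) (cong ⌊_⌋ (ren-cong (lift≗ext ρ) m)))
  renT-⌊⌋ ρ (pi a m)  =
    cong₂ Π (renT-⌊⌋ ρ a) (trans (renT-⌊⌋ (lift ρ) m) (cong ⌊_⌋ (ren-cong (lift≗ext ρ) m)))
  renT-⌊⌋ ρ (sort s)  = refl

  esub-⌊v⌋ : ∀ k n A → esub ⌊ n ⌋ A (var k nil) ↔* ⌊ n • k ⌋
  esub-⌊v⌋ zero    n A = ↔*-step σ-var₀ ◅◅ ↔*-step (app₂ σ-nil) ◅◅ ↔*-step app-nil
  esub-⌊v⌋ (suc k) n A = ↔*-step σ-varₛ ◅◅ ↔*-step (var₁ σ-nil)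

  -- The renaming ρ is needed to carry the induction through binders, where
  -- σ-ƛ and σ-Π exchange the two innermost variables.
  mutual
    esub-⌊⌋ : ∀ m ρ n A → esub ⌊ n ⌋ A ⌊ ren ρ m ⌋ ↔* ⌊ sub₀ n (ren ρ m) ⌋
    esub-⌊⌋ (v x)     ρ n A = esub-⌊v⌋ (ρ x) n A
    esub-⌊⌋ (t · u)   ρ n A =
      ↔*-step σ-app ◅◅ ↔*-step (app₂ σ-cons) ◅◅ ↔*-step (app₂ (cons₂ σ-nil)) ◅◅
      gmap (λ z → app z _) app₁ (esub-⌊⌋ t ρ n A) ◅◅
      gmap (λ z → app _ (z ∷ₗ nil)) (app₂ ∘ cons₁) (esub-⌊⌋ u ρ n A)
    esub-⌊⌋ (lam a m) ρ n A =
      ↔*-step σ-ƛ ◅◅ gmap (λ z → ƛ z _) ƛ₁ (esub-⌊⌋ a ρ n A) ◅◅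
      gmap (ƛ _) ƛ₂ (esub-⌊⌋-binder m ρ n A)
    esub-⌊⌋ (pi a m)  ρ n A =
      ↔*-step σ-Π ◅◅ gmap (λ z → Π z _) Π₁ (esub-⌊⌋ a ρ n A) ◅◅
      gmap (Π _) Π₂ (esub-⌊⌋-binder m ρ n A)
    esub-⌊⌋ (sort s)  ρ n A = ↔*-step σ-srt

    esub-⌊⌋-binder : ∀ m ρ n A →
      esub (wk ⌊ n ⌋) (wk A) (renT swap01 ⌊ ren (ext ρ) m ⌋) ↔* ⌊ sub (exts (n •_)) (ren (ext ρ) m) ⌋
    esub-⌊⌋-binder m ρ n A =
      ≡→↔* (cong₂ (λ p q → esub p (wk A) q) (renT-⌊⌋ suc n)
              (trans (renT-⌊⌋ swap01 (ren (ext ρ) m)) (cong ⌊_⌋ (ren-ren swap01 (ext ρ) m)))) ◅◅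
      esub-⌊⌋ m (swap01 ∘ ext ρ) (ren suc n) (wk A) ◅◅
      ≡→↔* (cong ⌊_⌋ (trans (cong (sub₀ (ren suc n)) (sym (ren-ren swap01 (ext ρ) m)))
                            (sub₀-swap n (ren (ext ρ) m))))

  esub-⌊⌋₀ : ∀ m n A → esub ⌊ n ⌋ A ⌊ m ⌋ ↔* ⌊ sub₀ n m ⌋
  esub-⌊⌋₀ m n A =
    subst (λ z → esub ⌊ n ⌋ A ⌊ z ⌋ ↔* ⌊ sub₀ n z ⌋) (ren-id (λ _ → refl) m) (esub-⌊⌋ m id n A)

  spine-⌊⌋ : ∀ t us → ⌊ spine t us ⌋ ↔* app ⌊ t ⌋ ⌊ us ⌋ₗ
  spine-⌊⌋ t []       = ↔*-sym (↔*-step app-nil)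
  spine-⌊⌋ t (u ∷ us) =
    spine-⌊⌋ (t · u) us ◅◅ ↔*-step app-app ◅◅ ↔*-step (app₂ cat-cons) ◅◅
    ↔*-step (app₂ (cons₂ cat-nil))

  ++-⌊⌋ : ∀ us ws → (⌊ us ⌋ₗ ++ₗ ⌊ ws ⌋ₗ) ↔ₗ* ⌊ us ++ ws ⌋ₗ
  ++-⌊⌋ []       ws = ↔ₗ*-step cat-nil
  ++-⌊⌋ (u ∷ us) ws = ↔ₗ*-step cat-cons ◅◅ gmap (⌊ u ⌋ ∷ₗ_) cons₂ (++-⌊⌋ us ws)

  esubₗ-⌊⌋ : ∀ n A us → esubₗ ⌊ n ⌋ A ⌊ us ⌋ₗ ↔ₗ* ⌊ map (sub₀ n) us ⌋ₗ
  esubₗ-⌊⌋ n A []       = ↔ₗ*-step σ-nil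
  esubₗ-⌊⌋ n A (u ∷ us) =
    ↔ₗ*-step σ-cons ◅◅ gmap (λ z → z ∷ₗ _) cons₁ (esub-⌊⌋₀ u n A) ◅◅
    gmap (_ ∷ₗ_) cons₂ (esubₗ-⌊⌋ n A us)

  mutual
    ↔*-⌊⟦⟧⌋ : ∀ M → M ↔* ⌊ ⟦ M ⟧ ⌋
    ↔*-⌊⟦⟧⌋ (Π A B)      = gmap (λ z → Π z B) Π₁ (↔*-⌊⟦⟧⌋ A) ◅◅ gmap (Π _) Π₂ (↔*-⌊⟦⟧⌋ B)
    ↔*-⌊⟦⟧⌋ (ƛ A B)      = gmap (λ z → ƛ z B) ƛ₁ (↔*-⌊⟦⟧⌋ A) ◅◅ gmap (ƛ _) ƛ₂ (↔*-⌊⟦⟧⌋ B)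
    ↔*-⌊⟦⟧⌋ (srt s)      = ε
    ↔*-⌊⟦⟧⌋ (var x l)    =
      gmap (var x) var₁ (↔ₗ*-⌊⟦⟧⌋ l) ◅◅ ↔*-sym (↔*-step (var₁ cat-nil)) ◅◅
      ↔*-sym (↔*-step app-var) ◅◅ ↔*-sym (spine-⌊⌋ (v x) ⟦ l ⟧ₗ)
    ↔*-⌊⟦⟧⌋ (app M l)    =
      gmap (λ z → app z l) app₁ (↔*-⌊⟦⟧⌋ M) ◅◅ gmap (app _) app₂ (↔ₗ*-⌊⟦⟧⌋ l) ◅◅
      ↔*-sym (spine-⌊⌋ ⟦ M ⟧ ⟦ l ⟧ₗ)
    ↔*-⌊⟦⟧⌋ (esub N A M) =
      gmap (λ z → esub z A M) esub₁ (↔*-⌊⟦⟧⌋ N) ◅◅ gmap (esub _ A) esub₃ (↔*-⌊⟦⟧⌋ M) ◅◅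
      esub-⌊⌋₀ ⟦ M ⟧ ⟦ N ⟧ A

    ↔ₗ*-⌊⟦⟧⌋ : ∀ l → l ↔ₗ* ⌊ ⟦ l ⟧ₗ ⌋ₗ
    ↔ₗ*-⌊⟦⟧⌋ nil           = ε
    ↔ₗ*-⌊⟦⟧⌋ (M ∷ₗ l)      = gmap (λ z → z ∷ₗ l) cons₁ (↔*-⌊⟦⟧⌋ M) ◅◅ gmap (_ ∷ₗ_) cons₂ (↔ₗ*-⌊⟦⟧⌋ l)
    ↔ₗ*-⌊⟦⟧⌋ (l ++ₗ l')    =
      gmap (λ z → z ++ₗ l') cat₁ (↔ₗ*-⌊⟦⟧⌋ l) ◅◅ gmap (_ ++ₗ_) cat₂ (↔ₗ*-⌊⟦⟧⌋ l') ◅◅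
      ++-⌊⌋ ⟦ l ⟧ₗ ⟦ l' ⟧ₗ
    ↔ₗ*-⌊⟦⟧⌋ (esubₗ N A l) =
      gmap (λ z → esubₗ z A l) esubₗ₁ (↔*-⌊⟦⟧⌋ N) ◅◅ gmap (esubₗ _ A) esubₗ₃ (↔ₗ*-⌊⟦⟧⌋ l) ◅◅
      esubₗ-⌊⌋ ⟦ N ⟧ A ⟦ l ⟧ₗ

  ⇒-⌊⌋ : ∀ {t t'} → t ⇒ t' → ⌊ t ⌋ ↔* ⌊ t' ⌋
  ⇒-⌊⌋ pvar       = ε
  ⇒-⌊⌋ psort      = ε
  ⇒-⌊⌋ (papp p q) =
    gmap (λ z → app z _) app₁ (⇒-⌊⌋ p) ◅◅ gmap (λ z → app _ (z ∷ₗ nil)) (app₂ ∘ cons₁) (⇒-⌊⌋ q)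
  ⇒-⌊⌋ (plam p q) = gmap (λ z → ƛ z _) ƛ₁ (⇒-⌊⌋ p) ◅◅ gmap (ƛ _) ƛ₂ (⇒-⌊⌋ q)
  ⇒-⌊⌋ (ppi p q)  = gmap (λ z → Π z _) Π₁ (⇒-⌊⌋ p) ◅◅ gmap (Π _) Π₂ (⇒-⌊⌋ q)
  ⇒-⌊⌋ (pbeta {a} {m} {m'} {n} {n'} p q) =
    gmap (λ z → app (ƛ _ z) _) (app₁ ∘ ƛ₂) (⇒-⌊⌋ p) ◅◅
    gmap (λ z → app _ (z ∷ₗ nil)) (app₂ ∘ cons₁) (⇒-⌊⌋ q) ◅◅
    ↔*-step β ◅◅ ↔*-step app-nil ◅◅ esub-⌊⌋₀ m' n' ⌊ a ⌋

  =β-to-↔* : ∀ {A B} → ⟦ A ⟧ =β ⟦ B ⟧ → A ↔* B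
  =β-to-↔* {A} {B} c = ↔*-⌊⟦⟧⌋ A ◅◅ read-back c ◅◅ ↔*-sym (↔*-⌊⟦⟧⌋ B)
    where
    read-back : ∀ {t u} → t =β u → ⌊ t ⌋ ↔* ⌊ u ⌋
    read-back ε            = ε
    read-back (fwd p ◅ ps) = ⇒-⌊⌋ p ◅◅ read-back ps
    read-back (bwd p ◅ ps) = ↔*-sym (⇒-⌊⌋ p) ◅◅ read-back ps

  same-image-↔* : ∀ {A B} → ⟦ A ⟧ ≡ ⟦ B ⟧ → A ↔* B
  same-image-↔* {A} e = =β-to-↔* (subst (⟦ A ⟧ =β_) e ε)

  Π-injective : ∀ {A B A' B'} → Π A B ↔* Π A' B' → (A ↔* A') × (B ↔* B')
  Π-injective c with pi-injective (↔*-to-=β c)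
  ... | cA , cB = =β-to-↔* cA , =β-to-↔* cB

  srt-injective : ∀ {s s'} → srt s ↔* srt s' → s ≡ s'
  srt-injective c = sort-injective (↔*-to-=β c)

  renT-↔* : ∀ ρ {A B} → A ↔* B → renT ρ A ↔* renT ρ B
  renT-↔* ρ {A} {B} c =
    =β-to-↔* (subst₂ _=β_ (sym (⟦renT⟧ ρ A)) (sym (⟦renT⟧ ρ B)) (gmap (ren ρ) (⇒-ren ρ) (↔*-to-=β c)))

-- Convertibilities of explicit substitutions, all verified on translations.

module SubstitutionConversions {S : Set} (Ax : S → S → Set) (Rl : S → S → S → Set) where

  open PTSC Ax Rl
  open Renaming Ax Rl
  open Lambda S
  open Conversion Ax Rl

  esub-wk : ∀ N G X → esub N G (wk X) ↔* X
  esub-wk N G X = same-image-↔* (trans (cong (sub₀ ⟦ N ⟧) (⟦renT⟧ suc X)) (sub₀-wk ⟦ N ⟧ ⟦ X ⟧))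

  esubAt-own-type : ∀ j P A →
    esubAt j P A (renT (λ k → suc (j + k)) A) ↔* renT (j +_) A
  esubAt-own-type j P A = ≡→↔* (cong (esub _ _) shifted) ◅◅ esub-wk _ _ (renT (j +_) A)
    where
    shifted : renT (mv j) (renT (λ k → suc (j + k)) A) ≡ wk (renT (j +_) A)
    shifted = trans (renT-renT (mv j) _ A)
                (trans (renT-cong (mv-above j) A) (sym (renT-renT suc (j +_) A)))

  esubAt-esub : ∀ ρ j P A M B D →
    renT ρ (esubAt j P A (esub M B D))
      ↔* esub (renT ρ (esubAt j P A M)) (renT ρ (esubAt j P A B)) (renT (lift ρ) (esubAt (suc j) P A D))
  esubAt-esub ρ j P A M B D = same-image-↔* (begin
      ⟦ renT ρ (esubAt j P A (esub M B D)) ⟧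
        ≡⟨ ⟦renT⟧ ρ (esubAt j P A (esub M B D)) ⟩
      ren ρ (sub₀ p (⟦ renT (mv j) (esub M B D) ⟧))
        ≡⟨ cong (λ z → ren ρ (sub₀ p z)) (trans (⟦renT⟧ (mv j) (esub M B D)) (ren-sub₀ (mv j) ⟦ M ⟧ ⟦ D ⟧)) ⟩
      ren ρ (sub₀ p (sub₀ m d))
        ≡⟨ cong (ren ρ) (sub-sub₀ (p •_) m d) ⟩
      ren ρ (sub₀ (sub₀ p m) (sub (exts (p •_)) d))
        ≡⟨ ren-sub₀ ρ (sub₀ p m) (sub (exts (p •_)) d) ⟩
      sub₀ (ren ρ (sub₀ p m)) (ren (ext ρ) (sub (exts (p •_)) d))
        ≡⟨ sym (cong₂ sub₀ image-M (trans (⟦renT-lift⟧ ρ (esubAt (suc j) P A D)) (cong (ren (ext ρ)) image-D))) ⟩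
      ⟦ esub (renT ρ (esubAt j P A M)) (renT ρ (esubAt j P A B)) (renT (lift ρ) (esubAt (suc j) P A D)) ⟧ ∎)
    where
    open ≡-Reasoning
    p = ⟦ renT (j +_) P ⟧
    m = ren (mv j) ⟦ M ⟧
    d = ren (ext (mv j)) ⟦ D ⟧
    image-M : ⟦ renT ρ (esubAt j P A M) ⟧ ≡ ren ρ (sub₀ p m)
    image-M = trans (⟦renT⟧ ρ (esubAt j P A M)) (cong (λ z → ren ρ (sub₀ p z)) (⟦renT⟧ (mv j) M))
    image-D : ⟦ esubAt (suc j) P A D ⟧ ≡ sub (exts (p •_)) d
    image-D = begin
      ⟦ esubAt (suc j) P A D ⟧
        ≡⟨ cong ⟦_⟧ (sym (esubAt-under-binder j P A D)) ⟩
      ⟦ esub (wk (renT (j +_) P)) (wk (renT (j +_) A)) (renT swap01 (renT (lift (mv j)) D)) ⟧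
        ≡⟨ ⟦σ-body⟧ (renT (j +_) P) (renT (j +_) A) (renT (lift (mv j)) D) ⟩
      sub (exts (p •_)) ⟦ renT (lift (mv j)) D ⟧
        ≡⟨ cong (sub (exts (p •_))) (⟦renT-lift⟧ (mv j) D) ⟩
      sub (exts (p •_)) d ∎

module Typing {S : Set} (Ax : S → S → Set) (Rl : S → S → S → Set) where

  open PTSC Ax Rl
  open Conversion Ax Rl using (↔*-sym; ↔*-step)

  mutual
    ⊢-wf : ∀ {Γ M A} → Γ ⊢ M ⦂ A → Γ wf
    ⊢-wf (sorted w _)   = w
    ⊢-wf (Πwf d _ _)    = ⊢-wf d
    ⊢-wf (ΠR d _)       = ⊢-wf d
    ⊢-wf (select d _)   = ⊢ₗ-wf d
    ⊢-wf (convR d _ _)  = ⊢-wf d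
    ⊢-wf (cut3 d _)     = ⊢-wf d
    ⊢-wf (cut4 _ _ _ w) = w

    ⊢ₗ-wf : ∀ {Γ B l C} → Γ ⍮ B ⊢ l ⦂ C → Γ wf
    ⊢ₗ-wf (axiom d)      = ⊢-wf d
    ⊢ₗ-wf (ΠL d _ _)     = ⊢-wf d
    ⊢ₗ-wf (conv'R d _ _) = ⊢ₗ-wf d
    ⊢ₗ-wf (convL d _ _)  = ⊢ₗ-wf d
    ⊢ₗ-wf (cut1 d _)     = ⊢ₗ-wf d
    ⊢ₗ-wf (cut2 _ _ _ w) = w

  wf-declared : ∀ Δ {A Γ} → (Δ ++ (A ∷ Γ)) wf → Σ S λ s → Γ ⊢ A ⦂ srt s
  wf-declared []      (extend d) = _ , d
  wf-declared (D ∷ Δ) (extend d) = wf-declared Δ (⊢-wf d)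

  Π-gen : ∀ {Γ A B C} → Γ ⊢ Π A B ⦂ C →
    Σ S λ s₁ → Σ S λ s₂ → Σ S λ s₃ →
      (Γ ⊢ A ⦂ srt s₁) × ((A ∷ Γ) ⊢ B ⦂ srt s₂) × Rl s₁ s₂ s₃ × (srt s₃ ↔* C)
  Π-gen (Πwf a b r) = _ , _ , _ , a , b , r , ε
  Π-gen (convR d _ c) with Π-gen d
  ... | s₁ , s₂ , s₃ , a , b , r , c' = s₁ , s₂ , s₃ , a , b , r , c' ◅◅ c

  ƛ-gen : ∀ {Γ A M C} → Γ ⊢ ƛ A M ⦂ C →
    Σ Tm λ B → Σ S λ s → (Γ ⊢ Π A B ⦂ srt s) × ((A ∷ Γ) ⊢ M ⦂ B) × (Π A B ↔* C)
  ƛ-gen (ΠR p m) = _ , _ , p , m , ε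
  ƛ-gen (convR d _ c) with ƛ-gen d
  ... | B , s , p , m , c' = B , s , p , m , c' ◅◅ c

  srt-gen : ∀ {Γ s C} → Γ ⊢ srt s ⦂ C → Σ S λ s' → Ax s s' × (srt s' ↔* C)
  srt-gen (sorted _ a) = _ , a , ε
  srt-gen (convR d _ c) with srt-gen d
  ... | s' , a , c' = s' , a , c' ◅◅ c

  var-gen : ∀ {Γ x l C} → Γ ⊢ var x l ⦂ C →
    Σ Tm λ A → Σ Tm λ B → (Γ ∋ x ⦂ A) × (Γ ⍮ A ⊢ l ⦂ B) × (B ↔* C)
  var-gen (select l x) = _ , _ , x , l , ε
  var-gen (convR d _ c) with var-gen d
  ... | A , B , x , l , c' = A , B , x , l , c' ◅◅ c

  app-gen : ∀ {Γ M l C} → Γ ⊢ app M l ⦂ C →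
    Σ Tm λ A → Σ Tm λ B → (Γ ⊢ M ⦂ A) × (Γ ⍮ A ⊢ l ⦂ B) × (B ↔* C)
  app-gen (cut3 m l) = _ , _ , m , l , ε
  app-gen (convR d _ c) with app-gen d
  ... | A , B , m , l , c' = A , B , m , l , c' ◅◅ c

  nil-gen : ∀ {Γ B C} → Γ ⍮ B ⊢ nil ⦂ C → B ↔* C
  nil-gen (axiom _)      = ε
  nil-gen (conv'R d _ c) = nil-gen d ◅◅ c
  nil-gen (convL d _ c)  = ↔*-sym c ◅◅ nil-gen d

  cons-gen : ∀ {Γ B M l C} → Γ ⍮ B ⊢ M ∷ₗ l ⦂ C →
    Σ Tm λ A → Σ Tm λ D → Σ S λ s → Σ Tm λ C' →
      (Γ ⊢ Π A D ⦂ srt s) × (Γ ⊢ M ⦂ A) × (Γ ⍮ esub M A D ⊢ l ⦂ C') × (B ↔* Π A D) × (C' ↔* C)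
  cons-gen (ΠL p m l) = _ , _ , _ , _ , p , m , l , ε , ε
  cons-gen (conv'R d _ c) with cons-gen d
  ... | A , D , s , C' , p , m , l , c₁ , c₂ = A , D , s , C' , p , m , l , c₁ , c₂ ◅◅ c
  cons-gen (convL d _ c) with cons-gen d
  ... | A , D , s , C' , p , m , l , c₁ , c₂ = A , D , s , C' , p , m , l , ↔*-sym c ◅◅ c₁ , c₂

  cat-gen : ∀ {Γ B l l' C} → Γ ⍮ B ⊢ l ++ₗ l' ⦂ C →
    Σ Tm λ B' → Σ Tm λ A → Σ Tm λ C' →
      (Γ ⍮ B' ⊢ l ⦂ A) × (Γ ⍮ A ⊢ l' ⦂ C') × (B ↔* B') × (C' ↔* C)
  cat-gen (cut1 a b) = _ , _ , _ , a , b , ε , ε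
  cat-gen (conv'R d _ c) with cat-gen d
  ... | B' , A , C' , a , b , c₁ , c₂ = B' , A , C' , a , b , c₁ , c₂ ◅◅ c
  cat-gen (convL d _ c) with cat-gen d
  ... | B' , A , C' , a , b , c₁ , c₂ = B' , A , C' , a , b , ↔*-sym c ◅◅ c₁ , c₂

  cut4Ty-cases : ∀ ρ j P A C →
    (Σ S λ s → (C ≡ srt s) × (cut4Ty ρ j P A C ≡ srt s)) ⊎ (cut4Ty ρ j P A C ≡ renT ρ (esubAt j P A C))
  cut4Ty-cases ρ j P A (Π _ _)      = inj₂ refl
  cut4Ty-cases ρ j P A (ƛ _ _)      = inj₂ refl
  cut4Ty-cases ρ j P A (srt s)      = inj₁ (s , refl , refl)
  cut4Ty-cases ρ j P A (var _ _)    = inj₂ refl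
  cut4Ty-cases ρ j P A (app _ _)    = inj₂ refl
  cut4Ty-cases ρ j P A (esub _ _ _) = inj₂ refl

  cut4Ty-↔* : ∀ ρ j P A C → cut4Ty ρ j P A C ↔* renT ρ (esubAt j P A C)
  cut4Ty-↔* ρ j P A C with cut4Ty-cases ρ j P A C
  ... | inj₁ (s , refl , _) = ↔*-sym (↔*-step σ-srt)
  ... | inj₂ e              = subst (_↔* renT ρ (esubAt j P A C)) (sym e) ε

  mutual
    type-correct : ∀ {Γ M C} → Γ ⊢ M ⦂ C → (Σ S λ s → C ≡ srt s) ⊎ (Σ S λ s → Γ ⊢ C ⦂ srt s)
    type-correct (sorted _ _)  = inj₁ (_ , refl)
    type-correct (Πwf _ _ _)   = inj₁ (_ , refl)
    type-correct (ΠR p _)      = inj₂ (_ , p)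
    type-correct (select l _)  = inj₂ (proj₂ (type-correctₗ l))
    type-correct (convR _ b _) = inj₂ (_ , b)
    type-correct (cut3 _ l)    = inj₂ (proj₂ (type-correctₗ l))
    type-correct (cut4 {Δ = Δ} {P = P} {A = A} {C = C} {ρ = ρ} p m sq w)
      with type-correct m | cut4Ty-cases ρ (length Δ) P A C
    ... | _                | inj₁ (s , _ , e) = inj₁ (s , e)
    ... | inj₁ (s , refl)  | inj₂ e           = inj₁ (s , refl)
    ... | inj₂ (s , dC)    | inj₂ e           =
      inj₂ (s , subst (λ z → _ ⊢ z ⦂ srt s) (sym e) (cut4 p dC sq w))

    type-correctₗ : ∀ {Γ B l C} → Γ ⍮ B ⊢ l ⦂ C →
      (Σ S λ s → Γ ⊢ B ⦂ srt s) × (Σ S λ s → Γ ⊢ C ⦂ srt s)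
    type-correctₗ (axiom d)      = (_ , d) , (_ , d)
    type-correctₗ (ΠL p _ l)     = (_ , p) , proj₂ (type-correctₗ l)
    type-correctₗ (conv'R l b _) = proj₁ (type-correctₗ l) , (_ , b)
    type-correctₗ (convL l b _)  = (_ , b) , proj₂ (type-correctₗ l)
    type-correctₗ (cut1 a b)     = proj₁ (type-correctₗ a) , proj₂ (type-correctₗ b)
    type-correctₗ (cut2 p l sq w) with type-correctₗ l
    ... | (s₁ , dB) , (s₂ , dC) = (s₁ , cut4 p dB sq w) , (s₂ , cut4 p dC sq w)

-- The
-- argument is the same for every family of inclusions that is closed under
-- extension and lets variables be re-typed in the target, so it is given
-- once (module Transport) and instantiated twice: for exact inclusions
-- (types renamed on the nose, which covers weakening) and then, using
-- weakening to type declarations, for the inclusions ⊑ of rules Cut₂/Cut₄.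

module Inclusions {S : Set} (Ax : S → S → Set) (Rl : S → S → S → Set) where

  open PTSC Ax Rl
  open Renaming Ax Rl
  open Conversion Ax Rl using (renT-↔*; ≡→↔*)
  open Typing Ax Rl
  open _⊑[_]_

  lift-injective : ∀ {ρ} → Injective _≡_ _≡_ ρ → Injective _≡_ _≡_ (lift ρ)
  lift-injective i {zero}  {zero}  e = refl
  lift-injective i {suc x} {suc y} e = cong suc (i (suc-injective e))

  ⊑-∘ : ∀ {Θ σ Θ' ρ Δ'} → Θ ⊑[ σ ] Θ' → Θ' ⊑[ ρ ] Δ' → Θ ⊑[ ρ ∘ σ ] Δ'
  ⊑-∘ {σ = σ} {ρ = ρ} inner outer = record
    { ρ-injective = ρ-injective inner ∘ ρ-injective outer
    ; ρ-decl      = decl }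
    where
    decl : ∀ {k T} → _ ∋ k ⦂ T → Σ Tm λ T' → (_ ∋ ρ (σ k) ⦂ T') × (renT (ρ ∘ σ) T ↔* T')
    decl {T = T} x with ρ-decl inner x
    ... | T₁ , x₁ , c₁ with ρ-decl outer x₁
    ... | T₂ , x₂ , c₂ = T₂ , x₂ , ≡→↔* (sym (renT-renT ρ σ T)) ◅◅ renT-↔* ρ c₁ ◅◅ c₂

  cut4Ty-renT : ∀ ρ σ j P A C → renT ρ (cut4Ty σ j P A C) ≡ cut4Ty (ρ ∘ σ) j P A C
  cut4Ty-renT ρ σ j P A (srt s)        = refl
  cut4Ty-renT ρ σ j P A C@(Π _ _)      = renT-renT ρ σ (esubAt j P A C)
  cut4Ty-renT ρ σ j P A C@(ƛ _ _)      = renT-renT ρ σ (esubAt j P A C)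
  cut4Ty-renT ρ σ j P A C@(var _ _)    = renT-renT ρ σ (esubAt j P A C)
  cut4Ty-renT ρ σ j P A C@(app _ _)    = renT-renT ρ σ (esubAt j P A C)
  cut4Ty-renT ρ σ j P A C@(esub _ _ _) = renT-renT ρ σ (esubAt j P A C)

  castₗ : ∀ {Γ B B' l l' C C'} → B ≡ B' → l ≡ l' → C ≡ C' → Γ ⍮ B ⊢ l ⦂ C → Γ ⍮ B' ⊢ l' ⦂ C'
  castₗ refl refl refl d = d

  record IsInclusion (_≼[_]_ : Ctx → (ℕ → ℕ) → Ctx → Set) : Set where
    field
      to-⊑     : ∀ {Θ ρ Δ'} → Θ ≼[ ρ ] Δ' → Θ ⊑[ ρ ] Δ'
      extend-≼ : ∀ {Θ ρ Δ'} A → Θ ≼[ ρ ] Δ' → (A ∷ Θ) ≼[ lift ρ ] (renT ρ A ∷ Δ')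
      var-≼    : ∀ {Θ ρ Δ' x T l C} → Θ ≼[ ρ ] Δ' → Δ' wf → Θ ∋ x ⦂ T →
                 Δ' ⍮ renT ρ T ⊢ l ⦂ C → Δ' ⊢ var (ρ x) l ⦂ C

  module Transport {_≼[_]_ : Ctx → (ℕ → ℕ) → Ctx → Set} (inc : IsInclusion _≼[_]_) where
    open IsInclusion inc

    -- Cut₂/Cut₄ already end in an inclusion; we compose it with the new one.
    mutual
      transport : ∀ {Θ ρ Δ' M C} → Θ ⊢ M ⦂ C → Θ ≼[ ρ ] Δ' → Δ' wf → Δ' ⊢ renT ρ M ⦂ renT ρ C
      transport (sorted _ a)  I w = sorted w a
      transport (Πwf {A = A} a b r) I w =
        Πwf (transport a I w) (transport b (extend-≼ A I) (extend (transport a I w))) r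
      transport (ΠR {A = A} p m) I w with Π-gen (transport p I w)
      ... | _ , _ , _ , a' , _ = ΠR (transport p I w) (transport m (extend-≼ A I) (extend a'))
      transport (select l x)  I w = var-≼ I w x (transportₗ l I w)
      transport (convR d b c) I w = convR (transport d I w) (transport b I w) (renT-↔* _ c)
      transport (cut3 m l)    I w = cut3 (transport m I w) (transportₗ l I w)
      transport {ρ = ρ} {Δ'} (cut4 {Δ = Δ} {P = P} {A} {M} {C} {σ} p m sq _) I w =
        subst₂ (Δ' ⊢_⦂_) (sym (renT-renT ρ σ (esubAt (length Δ) P A M)))
               (sym (cut4Ty-renT ρ σ (length Δ) P A C))
               (cut4 p m (⊑-∘ sq (to-⊑ I)) w)

      transportₗ : ∀ {Θ ρ Δ' B l C} → Θ ⍮ B ⊢ l ⦂ C → Θ ≼[ ρ ] Δ' → Δ' wf →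
                   Δ' ⍮ renT ρ B ⊢ renL ρ l ⦂ renT ρ C
      transportₗ (axiom d)      I w = axiom (transport d I w)
      transportₗ (ΠL p m l)     I w = ΠL (transport p I w) (transport m I w) (transportₗ l I w)
      transportₗ (conv'R l b c) I w = conv'R (transportₗ l I w) (transport b I w) (renT-↔* _ c)
      transportₗ (convL l b c)  I w = convL (transportₗ l I w) (transport b I w) (renT-↔* _ c)
      transportₗ (cut1 a b)     I w = cut1 (transportₗ a I w) (transportₗ b I w)
      transportₗ {ρ = ρ} (cut2 {Δ = Δ} {P = P} {A} {B} {l} {C} {σ} p m sq _) I w =
        castₗ (sym (renT-renT ρ σ (esubAt (length Δ) P A B)))
              (sym (renL-renL ρ σ (esubAtₗ (length Δ) P A l)))
              (sym (renT-renT ρ σ (esubAt (length Δ) P A C)))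
              (cut2 p m (⊑-∘ sq (to-⊑ I)) w)

  record _⊑≡[_]_ (Θ : Ctx) (ρ : ℕ → ℕ) (Δ' : Ctx) : Set where
    field
      injective : Injective _≡_ _≡_ ρ
      decl      : ∀ {k T} → Θ ∋ k ⦂ T → Δ' ∋ ρ k ⦂ renT ρ T
  open _⊑≡[_]_

  ⊑≡-extend : ∀ {Θ ρ Δ'} A → Θ ⊑≡[ ρ ] Δ' → (A ∷ Θ) ⊑≡[ lift ρ ] (renT ρ A ∷ Δ')
  ⊑≡-extend {ρ = ρ} {Δ'} A I = record { injective = lift-injective (injective I) ; decl = decl' }
    where
    decl' : ∀ {k T} → (A ∷ _) ∋ k ⦂ T → (renT ρ A ∷ _) ∋ lift ρ k ⦂ renT (lift ρ) T
    decl' here              = subst ((renT ρ A ∷ Δ') ∋ zero ⦂_) (wk-renT ρ A) here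
    decl' (there {A = T} x) = subst ((renT ρ A ∷ Δ') ∋ _ ⦂_) (wk-renT ρ T) (there (decl I x))

  exact-inclusion : IsInclusion _⊑≡[_]_
  exact-inclusion = record
    { to-⊑     = λ I → record { ρ-injective = injective I ; ρ-decl = λ x → _ , decl I x , ε }
    ; extend-≼ = ⊑≡-extend
    ; var-≼    = λ I w x l → select l (decl I x) }

  weaken : ∀ {Γ M C} A → Γ ⊢ M ⦂ C → (A ∷ Γ) wf → (A ∷ Γ) ⊢ wk M ⦂ wk C
  weaken A d = Transport.transport exact-inclusion d (record { injective = suc-injective ; decl = there })

  declared-sorted : ∀ {Γ x T} → Γ wf → Γ ∋ x ⦂ T → Σ S λ s → Γ ⊢ T ⦂ srt s
  declared-sorted (extend d) here = _ , weaken _ d (extend d)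
  declared-sorted (extend d) (there x) with declared-sorted (⊢-wf d) x
  ... | s , t = s , weaken _ t (extend d)

  ⊑-extend : ∀ {Θ ρ Δ'} A → Θ ⊑[ ρ ] Δ' → (A ∷ Θ) ⊑[ lift ρ ] (renT ρ A ∷ Δ')
  ⊑-extend {ρ = ρ} A I = record { ρ-injective = lift-injective (ρ-injective I) ; ρ-decl = decl' }
    where
    decl' : ∀ {k T} → (A ∷ _) ∋ k ⦂ T →
            Σ Tm λ T' → ((renT ρ A ∷ _) ∋ lift ρ k ⦂ T') × (renT (lift ρ) T ↔* T')
    decl' here = _ , here , ≡→↔* (sym (wk-renT ρ A))
    decl' (there {A = T} x) with ρ-decl I x
    ... | T' , x' , c = wk T' , there x' , ≡→↔* (sym (wk-renT ρ T)) ◅◅ renT-↔* suc c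

  inclusion : IsInclusion _⊑[_]_
  inclusion = record
    { to-⊑     = id
    ; extend-≼ = ⊑-extend
    ; var-≼    = var-⊑ }
    where
    var-⊑ : ∀ {Θ ρ Δ' x T l C} → Θ ⊑[ ρ ] Δ' → Δ' wf → Θ ∋ x ⦂ T →
            Δ' ⍮ renT ρ T ⊢ l ⦂ C → Δ' ⊢ var (ρ x) l ⦂ C
    var-⊑ I w x l with ρ-decl I x
    ... | T' , x' , c = select (convL l (proj₂ (declared-sorted w x')) c) x'

  open Transport inclusion public

module ContextLemmas {S : Set} (Ax : S → S → Set) (Rl : S → S → S → Set) where

  open PTSC Ax Rl
  open Renaming Ax Rl
  open Conversion Ax Rl
  open SubstitutionConversions Ax Rl using (esub-wk)
  open Typing Ax Rl
  open Inclusions Ax Rl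
  open _⊑[_]_

  infix 4 _≈_
  _≈_ : Ctx → Ctx → Set
  _≈_ = Pointwise _↔*_

  ≈-refl : ∀ {Θ} → Θ ≈ Θ
  ≈-refl = Pointwise.refl ε

  ≈-at : ∀ Δ {A A' Γ} → A ↔* A' → (Δ ++ (A ∷ Γ)) ≈ (Δ ++ (A' ∷ Γ))
  ≈-at Δ c = Pointwise.++⁺ ≈-refl (c ∷ ≈-refl)

  ≈-lookup : ∀ {Θ Θ' k T} → Θ ≈ Θ' → Θ ∋ k ⦂ T → Σ Tm λ T' → (Θ' ∋ k ⦂ T') × (T ↔* T')
  ≈-lookup (c ∷ cs) here = _ , here , renT-↔* suc c
  ≈-lookup (c ∷ cs) (there x) with ≈-lookup cs x
  ... | T' , x' , c' = wk T' , there x' , renT-↔* suc c'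

  ≈-⊑ : ∀ {Θ Θ'} → Θ ≈ Θ' → Θ ⊑[ id ] Θ'
  ≈-⊑ cs = record { ρ-injective = id ; ρ-decl = decl }
    where
    decl : ∀ {k T} → _ ∋ k ⦂ T → Σ Tm λ T' → (_ ∋ k ⦂ T') × (renT id T ↔* T')
    decl {T = T} x with ≈-lookup cs x
    ... | T' , x' , c = T' , x' , ≡→↔* (renT-id′ T) ◅◅ c

  ≈-⊑-⊑ : ∀ {Θ Θ' ρ Δ'} → Θ ≈ Θ' → Θ' ⊑[ ρ ] Δ' → Θ ⊑[ ρ ] Δ'
  ≈-⊑-⊑ cs I = ⊑-∘ (≈-⊑ cs) I

  ⊑-refl : ∀ Γ → Γ ⊑[ id ] Γ
  ⊑-refl Γ = ≈-⊑ ≈-refl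

  ≈-conv : ∀ {Θ Θ' M C} → Θ ⊢ M ⦂ C → Θ ≈ Θ' → Θ' wf → Θ' ⊢ M ⦂ C
  ≈-conv {M = M} {C} d cs w = subst₂ (_ ⊢_⦂_) (renT-id′ M) (renT-id′ C) (transport d (≈-⊑ cs) w)

  ≈-convₗ : ∀ {Θ Θ' B l C} → Θ ⍮ B ⊢ l ⦂ C → Θ ≈ Θ' → Θ' wf → Θ' ⍮ B ⊢ l ⦂ C
  ≈-convₗ {B = B} {l} {C} d cs w =
    castₗ (renT-id′ B) (renL-id (λ _ → refl) l) (renT-id′ C) (transportₗ d (≈-⊑ cs) w)

  wf-conv : ∀ Δ {A A' Γ s} → (Δ ++ (A ∷ Γ)) wf → Γ ⊢ A' ⦂ srt s → A ↔* A' → (Δ ++ (A' ∷ Γ)) wf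
  wf-conv []      (extend _)  a' c = extend a'
  wf-conv (D ∷ Δ) (extend dD) a' c = extend (≈-conv dD (≈-at Δ c) (wf-conv Δ (⊢-wf dD) a' c))

  retype-declaration : ∀ Δ {Γ A A' s M C} → Γ ⊢ A' ⦂ srt s → A ↔* A' →
    (Δ ++ (A ∷ Γ)) ⊢ M ⦂ C → (Δ ++ (A' ∷ Γ)) ⊢ M ⦂ C
  retype-declaration Δ dA' c D = ≈-conv D (≈-at Δ c) (wf-conv Δ (⊢-wf D) dA' c)

  retype-declarationₗ : ∀ Δ {Γ A A' s B l C} → Γ ⊢ A' ⦂ srt s → A ↔* A' →
    (Δ ++ (A ∷ Γ)) ⍮ B ⊢ l ⦂ C → (Δ ++ (A' ∷ Γ)) ⍮ B ⊢ l ⦂ C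
  retype-declarationₗ Δ dA' c D = ≈-convₗ D (≈-at Δ c) (wf-conv Δ (⊢ₗ-wf D) dA' c)

  esub-↔* : ∀ {N N' A A' M M'} → N ↔* N' → A ↔* A' → M ↔* M' → esub N A M ↔* esub N' A' M'
  esub-↔* c₁ c₂ c₃ =
    gmap (λ z → esub z _ _) esub₁ c₁ ◅◅ gmap (λ z → esub _ z _) esub₂ c₂ ◅◅
    gmap (λ z → esub _ _ z) esub₃ c₃

  esubAt-↔* : ∀ j {P P' A A' C C'} → P ↔* P' → A ↔* A' → C ↔* C' →
              esubAt j P A C ↔* esubAt j P' A' C'
  esubAt-↔* j c₁ c₂ c₃ = esub-↔* (renT-↔* (j +_) c₁) (renT-↔* (j +_) c₂) (renT-↔* (mv j) c₃)

  cut-↔* : ∀ ρ j {P P' A A' C C'} → P ↔* P' → A ↔* A' → C ↔* C' →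
           renT ρ (esubAt j P A C) ↔* renT ρ (esubAt j P' A' C')
  cut-↔* ρ j c₁ c₂ c₃ = renT-↔* ρ (esubAt-↔* j c₁ c₂ c₃)

  esubCtx-≈ : ∀ Δ {P P' A A'} → P ↔* P' → A ↔* A' → esubCtx P A Δ ≈ esubCtx P' A' Δ
  esubCtx-≈ []      c₁ c₂ = []
  esubCtx-≈ (D ∷ Δ) c₁ c₂ = esubAt-↔* (length Δ) c₁ c₂ ε ∷ esubCtx-≈ Δ c₁ c₂

  -- Γ,⟨P/x⟩_A Δ and Γ,⟨P'/x⟩_A' Δ are convertible, so Δ' includes both
  ⊑-reconv : ∀ Δ {Γ P P' A A' ρ Δ'} → P ↔* P' → A ↔* A' →
    (esubCtx P A Δ ++ Γ) ⊑[ ρ ] Δ' → (esubCtx P' A' Δ ++ Γ) ⊑[ ρ ] Δ'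
  ⊑-reconv Δ cP cA I = ≈-⊑-⊑ (Pointwise.++⁺ (esubCtx-≈ Δ (↔*-sym cP) (↔*-sym cA)) ≈-refl) I

  declared-x : ∀ Δ {A Γ T} → (Δ ++ (A ∷ Γ)) ∋ length Δ ⦂ T → T ≡ renT (λ k → suc (length Δ + k)) A
  declared-x []      here = refl
  declared-x (D ∷ Δ) {A} (there x) = trans (cong wk (declared-x Δ x)) (renT-renT suc _ A)

  declared-other : ∀ Δ {P A Γ x T y} → (Δ ++ (A ∷ Γ)) ∋ x ⦂ T → mv (length Δ) x ≡ suc y →
    Σ Tm λ T' → ((esubCtx P A Δ ++ Γ) ∋ y ⦂ T') × (T' ↔* esubAt (length Δ) P A T)
  declared-other [] (there {A = T} x) refl =
    T , x , ↔*-sym (≡→↔* (cong (esub _ _) (renT-id′ (wk T))) ◅◅ esub-wk _ _ T)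
  declared-other (D ∷ Δ) {P} {A} here refl = _ , here , ≡→↔* (wk-esubAt (length Δ) P A D)
  declared-other (D ∷ Δ) {P} {A} (there {n = x} {A = T} x∈) e with mv (length Δ) x in eq
  declared-other (D ∷ Δ) {P} {A} (there {n = x} {A = T} x∈) refl | suc y
    with declared-other Δ {P} x∈ eq
  ... | T' , y∈ , c = wk T' , there y∈ , renT-↔* suc c ◅◅ ≡→↔* (wk-esubAt (length Δ) P A T)

  ∋-shift : ∀ Ξ {Γ k T} → Γ ∋ k ⦂ T → (Ξ ++ Γ) ∋ length Ξ + k ⦂ renT (length Ξ +_) T
  ∋-shift []      {T = T} x = subst (_ ∋ _ ⦂_) (sym (renT-id′ T)) x
  ∋-shift (D ∷ Ξ) {T = T} x = subst ((D ∷ Ξ ++ _) ∋ _ ⦂_) (renT-renT suc (length Ξ +_) T) (there (∋-shift Ξ x))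

  ⊑-drop : ∀ Ξ {Γ ρ Δ'} → (Ξ ++ Γ) ⊑[ ρ ] Δ' → Γ ⊑[ ρ ∘ (length Ξ +_) ] Δ'
  ⊑-drop Ξ {ρ = ρ} I = record
    { ρ-injective = λ e → +-cancelˡ-≡ (length Ξ) _ _ (ρ-injective I e)
    ; ρ-decl      = decl }
    where
    decl : ∀ {k T} → _ ∋ k ⦂ T → Σ Tm λ T' → (_ ∋ ρ (length Ξ + k) ⦂ T') × (renT (ρ ∘ (length Ξ +_)) T ↔* T')
    decl {T = T} x with ρ-decl I (∋-shift Ξ x)
    ... | T' , x' , c = T' , x' , ≡→↔* (sym (renT-renT ρ (length Ξ +_) T)) ◅◅ c

  length-esubCtx : ∀ P A Δ → length (esubCtx P A Δ) ≡ length Δ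
  length-esubCtx P A []      = refl
  length-esubCtx P A (D ∷ Δ) = cong suc (length-esubCtx P A Δ)

  weaken-to-cut : ∀ Δ {Γ P A ρ Δ' X Y} → Γ ⊢ X ⦂ Y → (esubCtx P A Δ ++ Γ) ⊑[ ρ ] Δ' → Δ' wf →
    Δ' ⊢ renT ρ (renT (length Δ +_) X) ⦂ renT ρ (renT (length Δ +_) Y)
  weaken-to-cut Δ {P = P} {A} {ρ} {X = X} {Y} d I w =
    subst₂ (_ ⊢_⦂_) (shift X) (shift Y) (transport d (⊑-drop (esubCtx P A Δ) I) w)
    where
    shift : ∀ Z → renT (ρ ∘ (length (esubCtx P A Δ) +_)) Z ≡ renT ρ (renT (length Δ +_) Z)
    shift Z = trans (renT-cong (λ k → cong (λ n → ρ (n + k)) (length-esubCtx P A Δ)) Z)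
                    (sym (renT-renT ρ (length Δ +_) Z))

-- Fix p : Γ ⊢ P ⦂ A and an inclusion (Γ,⟨P/x⟩Δ) ⊑[ ρ ] Δ'; for each rule
-- σ-… we show that its reduct is typed in Δ' with the type given by Cut₄
-- (resp. Cut₂), by inverting the derivation of the term under ⟨P/x⟩.

module CutRules {S : Set} (Ax : S → S → Set) (Rl : S → S → S → Set) where

  open PTSC Ax Rl
  open Renaming Ax Rl
  open Conversion Ax Rl
  open SubstitutionConversions Ax Rl
  open Typing Ax Rl
  open Inclusions Ax Rl
  open ContextLemmas Ax Rl
  open _⊑[_]_

  var-index : ∀ {x y l l'} → var x l ≡ var y l' → x ≡ y
  var-index refl = refl

  var-spine : ∀ {x y l l'} → var x l ≡ var y l' → l ≡ l'
  var-spine refl = refl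

  -- Cut₄ with empty Δ and the identity inclusion types the plain ⟨N/x⟩_A M
  cut-id : ∀ N A M → renT id (esubAt 0 N A M) ≡ esub N A M
  cut-id N A M = trans (renT-id′ _) (cong₃ esub (renT-id′ N) (renT-id′ A) (renT-id′ M))

  from-C' : ∀ {Γ Δ Δ' P A ρ X C s} → Γ ⊢ P ⦂ A → (esubCtx P A Δ ++ Γ) ⊑[ ρ ] Δ' → Δ' wf →
    Δ' ⊢ X ⦂ cut4Ty ρ (length Δ) P A C → (Δ ++ (A ∷ Γ)) ⊢ C ⦂ srt s →
    Δ' ⊢ X ⦂ renT ρ (esubAt (length Δ) P A C)
  from-C' {Δ = Δ} {P = P} {A} {ρ} {C = C} p I w x d =
    convR x (cut4 p d I w) (cut4Ty-↔* ρ (length Δ) P A C)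

  module _ {Γ Δ Δ' P A ρ} (p : Γ ⊢ P ⦂ A) (I : (esubCtx P A Δ ++ Γ) ⊑[ ρ ] Δ') (w : Δ' wf) where

    private
      j  = length Δ
      Θ  = Δ ++ (A ∷ Γ)
      P₀ = renT (j +_) P
      A₀ = renT (j +_) A

    C'-sorted : ∀ {C s} → Θ ⊢ C ⦂ srt s → Σ S λ s' → Δ' ⊢ cut4Ty ρ j P A C ⦂ srt s'
    C'-sorted {C} d with cut4Ty-cases ρ j P A C
    ... | inj₁ (_ , refl , _) with srt-gen d
    ... | s' , ax , _ = s' , sorted w ax
    C'-sorted {C} {s} d | inj₂ e = s , subst (Δ' ⊢_⦂ srt s) (sym e) (cut4 p d I w)

    to-C' : ∀ {X C s} → Δ' ⊢ X ⦂ renT ρ (esubAt j P A C) → Θ ⊢ C ⦂ srt s → Δ' ⊢ X ⦂ cut4Ty ρ j P A C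
    to-C' {C = C} x d = convR x (proj₂ (C'-sorted d)) (↔*-sym (cut4Ty-↔* ρ j P A C))

    C'-conv : ∀ {X C₁ C s} → Δ' ⊢ X ⦂ cut4Ty ρ j P A C₁ → Θ ⊢ C ⦂ srt s → C₁ ↔* C →
              Δ' ⊢ X ⦂ cut4Ty ρ j P A C
    C'-conv {C₁ = C₁} {C} x d c =
      convR x (proj₂ (C'-sorted d))
        (cut4Ty-↔* ρ j P A C₁ ◅◅ cut-↔* ρ j ε ε c ◅◅ ↔*-sym (cut4Ty-↔* ρ j P A C))

    retarget : ∀ {M C X P' A'} → Θ ⊢ M ⦂ C → Δ' ⊢ X ⦂ cut4Ty ρ j P' A' C →
               renT ρ (esubAt j P' A' C) ↔* renT ρ (esubAt j P A C) → Δ' ⊢ X ⦂ cut4Ty ρ j P A C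
    retarget {C = C} {P' = P'} {A'} D x c with type-correct D
    ... | inj₁ (s , refl) = x
    ... | inj₂ (s , dC)   =
      convR x (proj₂ (C'-sorted dC)) (cut4Ty-↔* ρ j P' A' C ◅◅ c ◅◅ ↔*-sym (cut4Ty-↔* ρ j P A C))

    cut4-conv : ∀ {P' A' M C} → Γ ⊢ P' ⦂ A' → P ↔* P' → A ↔* A' →
      Θ ⊢ M ⦂ C → (Δ ++ (A' ∷ Γ)) ⊢ M ⦂ C → Δ' ⊢ renT ρ (esubAt j P' A' M) ⦂ cut4Ty ρ j P A C
    cut4-conv p' cP cA D D' =
      retarget D (cut4 p' D' (⊑-reconv Δ cP cA I) w) (cut-↔* ρ j (↔*-sym cP) (↔*-sym cA) ε)

    cut2-conv : ∀ {P' A' B l C} → Γ ⊢ P' ⦂ A' → P ↔* P' → A ↔* A' →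
      Θ ⍮ B ⊢ l ⦂ C → (Δ ++ (A' ∷ Γ)) ⍮ B ⊢ l ⦂ C →
      Δ' ⍮ renT ρ (esubAt j P A B) ⊢ renL ρ (esubAtₗ j P' A' l) ⦂ renT ρ (esubAt j P A C)
    cut2-conv {P'} {A'} p' cP cA D D' with type-correctₗ D
    ... | (_ , dB) , (_ , dC) =
      conv'R (convL (cut2 p' D' (⊑-reconv Δ cP cA I) w) (cut4 p dB I w) back) (cut4 p dC I w) back
      where
      back : ∀ {X} → renT ρ (esubAt j P' A' X) ↔* renT ρ (esubAt j P A X)
      back = cut-↔* ρ j (↔*-sym cP) (↔*-sym cA) ε

    Π-formation : ∀ {B D s₁ s₂ s₃} → Θ ⊢ B ⦂ srt s₁ → (B ∷ Θ) ⊢ D ⦂ srt s₂ → Rl s₁ s₂ s₃ →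
      (Δ' ⊢ renT ρ (esubAt j P A B) ⦂ srt s₁)
      × ((renT ρ (esubAt j P A B) ∷ Δ') ⊢ renT (lift ρ) (esubAt (suc j) P A D) ⦂ srt s₂)
      × (Δ' ⊢ Π (renT ρ (esubAt j P A B)) (renT (lift ρ) (esubAt (suc j) P A D)) ⦂ srt s₃)
    Π-formation {B} dB dD r = b' , d' , Πwf b' d' r
      where
      b' = cut4 p dB I w
      d' = cut4 {Δ = B ∷ Δ} p dD (⊑-extend _ I) (extend b')

    σ-Π-body : ∀ D → renT (lift ρ) (esub (wk P₀) (wk A₀) (renT swap01 (renT (lift (mv j)) D)))
                       ≡ renT (lift ρ) (esubAt (suc j) P A D)
    σ-Π-body D = cong (renT (lift ρ)) (esubAt-under-binder j P A D)

    esubAt-Π : ∀ B D → renT ρ (esubAt j P A (Π B D))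
                         ↔* Π (renT ρ (esubAt j P A B)) (renT (lift ρ) (esubAt (suc j) P A D))
    esubAt-Π B D =
      ↔*-step σ-Π ◅◅ ≡→↔* (cong (Π _) (trans (renT-σ-body ρ P₀ A₀ (renT (lift (mv j)) D)) (σ-Π-body D)))

    -- Each case below inverts the derivation of the term under ⟨P/x⟩; a final
    -- conversion of that derivation is carried along by C'-conv.

    σ-Π-typed : ∀ {M C B E} → Θ ⊢ M ⦂ C → renT (mv j) M ≡ Π B E →
      Δ' ⊢ renT ρ (Π (esub P₀ A₀ B) (esub (wk P₀) (wk A₀) (renT swap01 E))) ⦂ cut4Ty ρ j P A C
    σ-Π-typed (Πwf {A = B} {B = D} {s₃ = s₃} dB dD r) refl with Π-formation dB dD r
    ... | _ , _ , dΠ = subst (λ z → Δ' ⊢ Π (renT ρ (esubAt j P A B)) z ⦂ srt s₃) (sym (σ-Π-body D)) dΠ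
    σ-Π-typed (convR d dC c) e = C'-conv (σ-Π-typed d e) dC c

    σ-ƛ-typed : ∀ {M C B E} → Θ ⊢ M ⦂ C → renT (mv j) M ≡ ƛ B E →
      Δ' ⊢ renT ρ (ƛ (esub P₀ A₀ B) (esub (wk P₀) (wk A₀) (renT swap01 E))) ⦂ cut4Ty ρ j P A C
    σ-ƛ-typed (ΠR {A = B} {B = D} {M = E} dΠ dE) refl with Π-gen dΠ
    ... | s₁ , s₂ , s₃ , dB , dD , r , c with Π-formation dB dD r
    ... | b' , _ , dΠ' = convR (ΠR dΠ'' body) (cut4 p dΠ I w) (↔*-sym (esubAt-Π B D))
      where
      dΠ'' = subst (λ s → Δ' ⊢ Π (renT ρ (esubAt j P A B)) (renT (lift ρ) (esubAt (suc j) P A D)) ⦂ srt s)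
                   (srt-injective c) dΠ'
      I'   = ⊑-extend (esubAt j P A B) I
      body = subst (λ z → (renT ρ (esubAt j P A B) ∷ Δ') ⊢ z ⦂ renT (lift ρ) (esubAt (suc j) P A D))
                   (sym (σ-Π-body E))
                   (from-C' {Δ = B ∷ Δ} p I' (extend b') (cut4 {Δ = B ∷ Δ} p dE I' (extend b')) dD)
    σ-ƛ-typed (convR d dC c) e = C'-conv (σ-ƛ-typed d e) dC c

    σ-srt-typed : ∀ {M C s} → Θ ⊢ M ⦂ C → renT (mv j) M ≡ srt s → Δ' ⊢ srt s ⦂ cut4Ty ρ j P A C
    σ-srt-typed (sorted _ ax)  refl = sorted w ax
    σ-srt-typed (convR d dC c) e    = C'-conv (σ-srt-typed d e) dC c

    σ-app-typed : ∀ {M C M₁ l₁} → Θ ⊢ M ⦂ C → renT (mv j) M ≡ app M₁ l₁ →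
      Δ' ⊢ renT ρ (app (esub P₀ A₀ M₁) (esubₗ P₀ A₀ l₁)) ⦂ cut4Ty ρ j P A C
    σ-app-typed (cut3 dM dl) refl with type-correctₗ dl
    ... | (_ , dT) , (_ , dC) = to-C' (cut3 (from-C' p I w (cut4 p dM I w) dT) (cut2 p dl I w)) dC
    σ-app-typed (convR d dC c) e = C'-conv (σ-app-typed d e) dC c

    -- the substituted variable x itself: its declared type A₀ becomes the type of P
    σ-var₀-typed : ∀ {M C l₁} → Θ ⊢ M ⦂ C → renT (mv j) M ≡ var zero l₁ →
      Δ' ⊢ renT ρ (app P₀ (esubₗ P₀ A₀ l₁)) ⦂ cut4Ty ρ j P A C
    σ-var₀-typed (select {A = T} {x = x} dl x∈) e
      with mv-zero j x (var-index e) | var-spine e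
    ... | refl | refl with type-correctₗ dl | wf-declared Δ (⊢ₗ-wf dl)
    ... | _ , (_ , dC) | _ , dA =
      to-C' (cut3 (weaken-to-cut Δ p I w) (convL (cut2 p dl I w) (weaken-to-cut Δ dA I w) own-type)) dC
      where
      own-type : renT ρ (esubAt j P A T) ↔* renT ρ (renT (j +_) A)
      own-type = ≡→↔* (cong (λ z → renT ρ (esubAt j P A z)) (declared-x Δ x∈)) ◅◅
                 renT-↔* ρ (esubAt-own-type j P A)
    σ-var₀-typed (convR d dC c) e = C'-conv (σ-var₀-typed d e) dC c

    σ-varₛ-typed : ∀ {M C y l₁} → Θ ⊢ M ⦂ C → renT (mv j) M ≡ var (suc y) l₁ →
      Δ' ⊢ renT ρ (var y (esubₗ P₀ A₀ l₁)) ⦂ cut4Ty ρ j P A C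
    σ-varₛ-typed (select {A = T} dl x∈) e with var-spine e
    ... | refl with declared-other Δ {P} x∈ (var-index e) | type-correctₗ dl
    ... | T' , y∈ , c | _ , (_ , dC) with ρ-decl I y∈
    ... | T'' , y∈' , c' =
      to-C' (select (convL (cut2 p dl I w) (proj₂ (declared-sorted w y∈')) (↔*-sym (renT-↔* ρ c) ◅◅ c')) y∈') dC
    σ-varₛ-typed (convR d dC c) e = C'-conv (σ-varₛ-typed d e) dC c

    σ-nil-typed : ∀ {B l C} → Θ ⍮ B ⊢ l ⦂ C → renL (mv j) l ≡ nil →
      Δ' ⍮ renT ρ (esubAt j P A B) ⊢ nil ⦂ renT ρ (esubAt j P A C)
    σ-nil-typed (axiom dB)      refl = axiom (cut4 p dB I w)
    σ-nil-typed (conv'R d dC c) e    = conv'R (σ-nil-typed d e) (cut4 p dC I w) (cut-↔* ρ j ε ε c)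
    σ-nil-typed (convL d dB c)  e    = convL (σ-nil-typed d e) (cut4 p dB I w) (cut-↔* ρ j ε ε c)

    σ-cons-typed : ∀ {B l C M₁ l₁} → Θ ⍮ B ⊢ l ⦂ C → renL (mv j) l ≡ (M₁ ∷ₗ l₁) →
      Δ' ⍮ renT ρ (esubAt j P A B) ⊢ renL ρ (esub P₀ A₀ M₁ ∷ₗ esubₗ P₀ A₀ l₁) ⦂ renT ρ (esubAt j P A C)
    σ-cons-typed (ΠL {A = B} {B = D} {M = M} dΠ dM dl) refl with Π-gen dΠ
    ... | s₁ , s₂ , s₃ , dB , dD , r , _ with Π-formation dB dD r
    ... | _ , d' , dΠ' = convL (ΠL dΠ' m' l') (cut4 p dΠ I w) (↔*-sym (esubAt-Π B D))
      where
      m'  = from-C' p I w (cut4 p dM I w) dB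
      dD' = subst (Δ' ⊢_⦂ srt s₂) (cut-id _ _ _) (cut4 {Δ = []} m' d' (⊑-refl Δ') w)
      l'  = convL (cut2 p dl I w) dD' (esubAt-esub ρ j P A M B D)
    σ-cons-typed (conv'R d dC c) e = conv'R (σ-cons-typed d e) (cut4 p dC I w) (cut-↔* ρ j ε ε c)
    σ-cons-typed (convL d dB c)  e = convL (σ-cons-typed d e) (cut4 p dB I w) (cut-↔* ρ j ε ε c)

    σ-cat-typed : ∀ {B l C l₁ l₂} → Θ ⍮ B ⊢ l ⦂ C → renL (mv j) l ≡ (l₁ ++ₗ l₂) →
      Δ' ⍮ renT ρ (esubAt j P A B) ⊢ renL ρ (esubₗ P₀ A₀ l₁ ++ₗ esubₗ P₀ A₀ l₂) ⦂ renT ρ (esubAt j P A C)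
    σ-cat-typed (cut1 a b)      refl = cut1 (cut2 p a I w) (cut2 p b I w)
    σ-cat-typed (conv'R d dC c) e    = conv'R (σ-cat-typed d e) (cut4 p dC I w) (cut-↔* ρ j ε ε c)
    σ-cat-typed (convL d dB c)  e    = convL (σ-cat-typed d e) (cut4 p dB I w) (cut-↔* ρ j ε ε c)

module SubjectReduction {S : Set} (Ax : S → S → Set) (Rl : S → S → S → Set) where

  open PTSC Ax Rl
  open StepsOfRenamings Ax Rl
  open Conversion Ax Rl
  open Typing Ax Rl
  open ContextLemmas Ax Rl
  open CutRules Ax Rl

  -- β: λx^A.M has a type Π A E and the list starts at a convertible Π A' E';
  -- by Π-injectivity N is typed with A, Cut₄ types ⟨N/x⟩M with ⟨N/x⟩E, and the
  -- rest of the list is retyped from ⟨N/x⟩_{A'} E' to ⟨N/x⟩_A E.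
  β-typed : ∀ {Γ A M N l T B} → Γ ⊢ ƛ A M ⦂ T → Γ ⍮ T ⊢ N ∷ₗ l ⦂ B → Γ ⊢ app (esub N A M) l ⦂ B
  β-typed {Γ} {A} {M} {N} dƛ dl with ƛ-gen dƛ | cons-gen dl
  ... | E , _ , dΠ , dM , c₁ | _ , _ , _ , _ , _ , dN , dl' , c₂ , c₃
    with Π-injective (c₁ ◅◅ c₂) | Π-gen dΠ | type-correctₗ dl
  ... | cA , cE | _ , _ , _ , dA , dE , _ , _ | _ , (_ , dB) =
    cut3 dN[M] (conv'R (convL dl' (proj₂ (C'-sorted {Δ = []} dN' (⊑-refl Γ) w dE)) cE') dB c₃)
    where
    w    = ⊢-wf dƛ
    dN'  = convR dN dA (↔*-sym cA)
    dN[M] = subst (Γ ⊢_⦂ cut4Ty id 0 N A E) (cut-id N A M) (cut4 {Δ = []} dN' dM (⊑-refl Γ) w)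
    cE'  = esub-↔* ε (↔*-sym cA) (↔*-sym cE) ◅◅ ≡→↔* (sym (cut-id N A E)) ◅◅
           ↔*-sym (cut4Ty-↔* id 0 N A E)

  cat-cons-typed : ∀ {Γ C M l' A l B} → Γ ⍮ C ⊢ M ∷ₗ l' ⦂ A → Γ ⍮ A ⊢ l ⦂ B →
    Γ ⍮ C ⊢ M ∷ₗ (l' ++ₗ l) ⦂ B
  cat-cons-typed a b with cons-gen a | type-correctₗ a | type-correctₗ b
  ... | _ , _ , _ , _ , dΠ , dM , dl , c₁ , c₂ | (_ , dC) , _ | (_ , dA) , _ =
    convL (ΠL dΠ dM (cut1 (conv'R dl dA c₂) b)) dC (↔*-sym c₁)

  cat-assoc-typed : ∀ {Γ C l l' A l'' B} → Γ ⍮ C ⊢ l ++ₗ l' ⦂ A → Γ ⍮ A ⊢ l'' ⦂ B →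
    Γ ⍮ C ⊢ l ++ₗ (l' ++ₗ l'') ⦂ B
  cat-assoc-typed a b with cat-gen a | type-correctₗ a | type-correctₗ b
  ... | _ , _ , _ , a₁ , a₂ , c₁ , c₂ | (_ , dC) , _ | (_ , dA) , _ =
    cut1 (convL a₁ dC (↔*-sym c₁)) (cut1 (conv'R a₂ dA c₂) b)

  head-conv : ∀ {Γ A B s M M' l C} → Γ ⊢ Π A B ⦂ srt s → Γ ⊢ M' ⦂ A → M ↔* M' →
    Γ ⍮ esub M A B ⊢ l ⦂ C → Γ ⍮ Π A B ⊢ M' ∷ₗ l ⦂ C
  head-conv {Γ} {A} {B} dΠ dM' c dl with Π-gen dΠ
  ... | _ , s₂ , _ , _ , dB , _ , _ = ΠL dΠ dM' (convL dl dB' (esub-↔* c ε ε))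
    where
    dB' = subst (Γ ⊢_⦂ srt s₂) (cut-id _ A B) (cut4 {Δ = []} dM' dB (⊑-refl Γ) (⊢-wf dΠ))

  -- fuel bookkeeping: a reflected step has the depth of the original one
  within : ∀ {a b n} → a ≡ b → suc b ≤ n → a ≤ n
  within refl le = <⇒≤ le

  -- The main induction: on a bound n for the depth of the step, then on the
  -- derivation.  Conversions are commuted past the step; the syntax-directed
  -- rules either hit a congruence (use the induction hypothesis) or a root
  -- step; in Cut₂/Cut₄ the step is first reflected along the renaming ρ.
  mutual
    sr : ∀ n {Γ M M' A} → Γ ⊢ M ⦂ A → (r : M ⟶ M') → depth r ≤ n → Γ ⊢ M' ⦂ A
    sr n (sorted _ _) () _
    sr n (Πwf a b k) (Π₁ r) le = Πwf a' (≈-conv b (↔*-step r ∷ ≈-refl) (extend a')) k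
      where a' = sr n a r (<⇒≤ le)
    sr n (Πwf a b k) (Π₂ r) le = Πwf a (sr n b r (<⇒≤ le)) k
    sr n (ΠR p m) (ƛ₁ r) le with sr n p (Π₁ r) le
    ... | p' with Π-gen p'
    ... | _ , _ , _ , a' , _ =
      convR (ΠR p' (≈-conv m (↔*-step r ∷ ≈-refl) (extend a'))) p (↔*-sym (↔*-step (Π₁ r)))
    sr n (ΠR p m)      (ƛ₂ r)   le = ΠR p (sr n m r (<⇒≤ le))
    sr n (select l x)  (var₁ r) le = select (srₗ n l r (<⇒≤ le)) x
    sr n (convR d b c) r        le = convR (sr n d r le) b c
    sr n (cut3 m l)    β        _  = β-typed m l
    sr n (cut3 m l)    app-nil  _  = convR m (proj₂ (proj₂ (type-correctₗ l))) (nil-gen l)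
    sr n (cut3 m l)    app-var  _  with var-gen m | type-correctₗ l
    ... | _ , _ , x , l₀ , c | (_ , dA) , _ = select (cut1 (conv'R l₀ dA c) l) x
    sr n (cut3 m l)    app-app  _  with app-gen m | type-correctₗ l
    ... | _ , _ , m₀ , l₀ , c | (_ , dA) , _ = cut3 m₀ (cut1 (conv'R l₀ dA c) l)
    sr n (cut3 m l)    (app₁ r) le = cut3 (sr n m r (<⇒≤ le)) l
    sr n (cut3 m l)    (app₂ r) le = cut3 m (srₗ n l r (<⇒≤ le))
    sr n (cut4 {Δ = Δ} {P = P} {A} {M} {ρ = ρ} p D I w) r le
      with reflect ρ r (esubAt (length Δ) P A M) refl
    ... | preimage r' refl d = sr-cut4 n p D I w r' refl (subst (_≤ n) (sym d) le)

    sr-cut4 : ∀ n {Γ Δ Δ' P A M C ρ T} (p : Γ ⊢ P ⦂ A) (D : (Δ ++ (A ∷ Γ)) ⊢ M ⦂ C)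
      (I : (esubCtx P A Δ ++ Γ) ⊑[ ρ ] Δ') (w : Δ' wf) {Z} →
      (r : esub (renT (length Δ +_) P) (renT (length Δ +_) A) Z ⟶ T) → renT (mv (length Δ)) M ≡ Z →
      depth r ≤ n → Δ' ⊢ renT ρ T ⦂ cut4Ty ρ (length Δ) P A C
    sr-cut4 n {Δ = Δ} p D I w (esub₁ r) refl le with reflect (length Δ +_) r _ refl
    ... | preimage rP refl d = cut4-conv p I w (sr n p rP (within d le)) (↔*-step rP) ε D D
    sr-cut4 (suc n) {Δ = Δ} p D I w (esub₂ r) refl (s≤s le)
      with reflect (length Δ +_) r _ refl | wf-declared Δ (⊢-wf D)
    ... | preimage rA refl d | _ , dA =
      cut4-conv p I w (convR p dA' (↔*-step rA)) ε (↔*-step rA) D (retype-declaration Δ dA' (↔*-step rA) D)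
      where dA' = sr n dA rA (subst (_≤ n) (sym d) le)
    sr-cut4 n {Δ = Δ} {M = M} p D I w (esub₃ r) refl le with reflect (mv (length Δ)) r M refl
    ... | preimage rM refl d = cut4 p (sr n D rM (within d le)) I w
    sr-cut4 n p D I w σ-ƛ    e _ = σ-ƛ-typed p I w D e
    sr-cut4 n p D I w σ-Π    e _ = σ-Π-typed p I w D e
    sr-cut4 n p D I w σ-srt  e _ = σ-srt-typed p I w D e
    sr-cut4 n p D I w σ-var₀ e _ = σ-var₀-typed p I w D e
    sr-cut4 n p D I w σ-varₛ e _ = σ-varₛ-typed p I w D e
    sr-cut4 n p D I w σ-app  e _ = σ-app-typed p I w D e

    srₗ : ∀ n {Γ B l l' C} → Γ ⍮ B ⊢ l ⦂ C → (r : l ⟶ₗ l') → depthₗ r ≤ n → Γ ⍮ B ⊢ l' ⦂ C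
    srₗ n (axiom _) () _
    srₗ n (ΠL dΠ m l)    (cons₁ r) le = head-conv dΠ (sr n m r (<⇒≤ le)) (↔*-step r) l
    srₗ n (ΠL dΠ m l)    (cons₂ r) le = ΠL dΠ m (srₗ n l r (<⇒≤ le))
    srₗ n (conv'R d b c) r         le = conv'R (srₗ n d r le) b c
    srₗ n (convL d b c)  r         le = convL (srₗ n d r le) b c
    srₗ n (cut1 a b)     cat-cons  _  = cat-cons-typed a b
    srₗ n (cut1 a b)     cat-nil   _  = convL b (proj₂ (proj₁ (type-correctₗ a))) (↔*-sym (nil-gen a))
    srₗ n (cut1 a b)     cat-assoc _  = cat-assoc-typed a b
    srₗ n (cut1 a b)     cat-nilʳ  _  = conv'R a (proj₂ (proj₂ (type-correctₗ b))) (nil-gen b)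
    srₗ n (cut1 a b)     (cat₁ r)  le = cut1 (srₗ n a r (<⇒≤ le)) b
    srₗ n (cut1 a b)     (cat₂ r)  le = cut1 a (srₗ n b r (<⇒≤ le))
    srₗ n (cut2 {Δ = Δ} {P = P} {A = A} {l = l} {ρ = ρ} p D I w) r le
      with reflectₗ ρ r (esubAtₗ (length Δ) P A l) refl
    ... | preimage r' refl d = sr-cut2 n p D I w r' refl (subst (_≤ n) (sym d) le)

    sr-cut2 : ∀ n {Γ Δ Δ' P A B l C ρ T} (p : Γ ⊢ P ⦂ A) (D : (Δ ++ (A ∷ Γ)) ⍮ B ⊢ l ⦂ C)
      (I : (esubCtx P A Δ ++ Γ) ⊑[ ρ ] Δ') (w : Δ' wf) {Z} →
      (r : esubₗ (renT (length Δ +_) P) (renT (length Δ +_) A) Z ⟶ₗ T) → renL (mv (length Δ)) l ≡ Z →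
      depthₗ r ≤ n → Δ' ⍮ renT ρ (esubAt (length Δ) P A B) ⊢ renL ρ T ⦂ renT ρ (esubAt (length Δ) P A C)
    sr-cut2 n {Δ = Δ} p D I w (esubₗ₁ r) refl le with reflect (length Δ +_) r _ refl
    ... | preimage rP refl d = cut2-conv p I w (sr n p rP (within d le)) (↔*-step rP) ε D D
    sr-cut2 (suc n) {Δ = Δ} p D I w (esubₗ₂ r) refl (s≤s le)
      with reflect (length Δ +_) r _ refl | wf-declared Δ (⊢ₗ-wf D)
    ... | preimage rA refl d | _ , dA =
      cut2-conv p I w (convR p dA' (↔*-step rA)) ε (↔*-step rA) D (retype-declarationₗ Δ dA' (↔*-step rA) D)
      where dA' = sr n dA rA (subst (_≤ n) (sym d) le)
    sr-cut2 n {Δ = Δ} {l = l} p D I w (esubₗ₃ r) refl le with reflectₗ (mv (length Δ)) r l refl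
    ... | preimage rl refl d = cut2 p (srₗ n D rl (within d le)) I w
    sr-cut2 n p D I w σ-nil  e _ = σ-nil-typed p I w D e
    sr-cut2 n p D I w σ-cons e _ = σ-cons-typed p I w D e
    sr-cut2 n p D I w σ-cat  e _ = σ-cat-typed p I w D e

theorem3p7 : {S : Set} (Ax : S → S → Set) (Rl : S → S → S → Set) →
    let open PTSC Ax Rl in
    ((Γ : Ctx) (M M' A : Tm) → Γ ⊢ M ⦂ A → M ⟶ M' → Γ ⊢ M' ⦂ A)
    × ((Γ : Ctx) (B C : Tm) (l l' : Lst) → Γ ⍮ B ⊢ l ⦂ C → l ⟶ₗ l' → Γ ⍮ B ⊢ l' ⦂ C)
theorem3p7 Ax Rl =
  (λ Γ M M' A d r → sr (depth r) d r ≤-refl) ,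
  (λ Γ B C l l' d r → srₗ (depthₗ r) d r ≤-refl)
  where
  open SubjectReduction Ax Rl
  open StepsOfRenamings Ax Rl using (depth; depthₗ)
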